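{- Let $r$ be a positive integer, let $s,t$ be integers with $0\le s,t\le r-1$, and let $h$ be a positive integer with $r<\phi^h$. Then there exists a Hofstadter G pair $(u,v)$ with $u\equiv s\pmod r$ and $v\equiv t\pmod r$ such that $v$ has a Fibonacci representation of length at most $2h-1$.
   Context: $F_0=0$, $F_1=1$, $F_i=F_{i-1}+F_{i-2}$ are the Fibonacci numbers and $\phi=(1+\sqrt5)/2$. For a bit string $\beta=\langle\beta_1\ldots\beta_\ell\rangle$ ($\beta_i\in\{0,1\}$, length $\ell$), $\mathrm{FibSum}(\beta)=\sum_{i=1}^\ell\beta_iF_{i+1}$; $\beta$ is a Fibonacci representation of $n$ if $\mathrm{FibSum}(\beta)=n$. Hofstadter's G function is $G(x)=\lfloor\phi^{ -1}(x+1)\rfloor$ for integers $x\ge0$. A Hofstadter G pair is a pair $(u,v)$ of positive integers with $u=G(v)$. -}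

module Defs where

open import Data.Nat using (ℕ; zero; suc; _+_; _*_; _∸_; _≤_; _<_)
open import Data.Bool using (Bool; true; false)
open import Data.List using (List; []; _∷_)
open import Data.Product using (_×_)

F : ℕ → ℕ
F zero = 0
F (suc zero) = 1
F (suc (suc i)) = F (suc i) + F i

-- Exact comparisons between a natural number a and b·φ, φ = (1+√5)/2,
-- written out in integer arithmetic (no reals in agda-stdlib):
--   a < b·φ  ⇔ 2a - b < b√5  ⇔ (2a ∸ b)² < 5b²
--   b·φ ≤ a  ⇔ b√5 ≤ 2a - b  ⇔ 5b² ≤ (2a ∸ b)²
_<φ·_ : ℕ → ℕ → Set
a <φ· b = (2 * a ∸ b) * (2 * a ∸ b) < 5 * (b * b)

φ·_≤_ : ℕ → ℕ → Set
φ· b ≤ a = 5 * (b * b) ≤ (2 * a ∸ b) * (2 * a ∸ b)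

-- r < φ^h, using φ^h = F(h-1) + F(h)·φ for h ≥ 1:
--   r < φ^h ⇔ r - F(h-1) < F(h)·φ
_<φ^_ : ℕ → ℕ → Set
r <φ^ h = (r ∸ F (h ∸ 1)) <φ· F h

-- Hofstadter G: G x = ⌊φ⁻¹ (x+1)⌋.  "IsG u x" means u = G x, i.e.
-- u ≤ (x+1)/φ < u+1, i.e.  u·φ ≤ x+1 < (u+1)·φ.
IsG : ℕ → ℕ → Set
IsG u x = (φ· u ≤ (x + 1)) × ((x + 1) <φ· (u + 1))

HofstadterGPair : ℕ → ℕ → Set
HofstadterGPair u v = (0 < u) × (0 < v) × IsG u v

fibSumFrom : ℕ → List Bool → ℕ
fibSumFrom k [] = 0
fibSumFrom k (true ∷ bs) = F k + fibSumFrom (suc k) bs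
fibSumFrom k (false ∷ bs) = fibSumFrom (suc k) bs

FibSum : List Bool → ℕ
FibSum β = fibSumFrom 2 β

{-# OPTIONS --safe #-}
module Submission where

-- u = G v means u φ ≤ v + 1 < (u + 1) φ, an inequality in ℤ[φ], which is
-- decided exactly by the signs of the coordinates of φᵏ x for large k.
-- Fix t and let y run through the multiples of A = F (h + 1) modulo
-- N = F (h + 2), i.e. step by +F (h + 1) or -F h.  Then v = t + r y moves
-- v + 1 - u φ by r ψʰ or -r ψʰ⁻¹ (ψ = -1/φ): both have the sign (-1)ʰ and,
-- as r < φʰ, size below φ.  So G v, corrected by a multiple of r, changes
-- by 0 or (-1)ʰ per step, and by Cassini's identity it sweeps through r
-- consecutive values in one round: every residue of u occurs with
-- v ≡ t (mod r) and v < r N.  As N L = F (2h + 2) + (-1)ʰ for the Lucas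
-- number L = φʰ + ψʰ > r + ψʰ, this gives v + 2 ≤ F (2h + 2), so v has a
-- Fibonacci representation of length 2h - 1.
-- For u ≡ v ≡ 0 one takes v = r F (h + 1) or v = r F (h + 2) instead.

open import Defs
open import Data.Nat using (ℕ; _∸_; _*_; _≤_; _<_; NonZero)
open import Data.Nat.DivMod using (_%_)
open import Data.List using (List; length)
open import Data.Bool using (Bool)
open import Data.Product using (_×_; ∃-syntax)
open import Relation.Binary.PropositionalEquality using (_≡_)

open import Data.Nat using (zero; suc; _+_; z≤n; s≤s; _≤?_; _<?_; _≟_)
import Data.Nat.Properties as ℕ
open import Data.Nat.DivMod using ([m+kn]%n≡m%n; m*n%n≡0; m<n⇒m%n≡m)
open import Data.Nat.Tactic.RingSolver renaming (solve to solveℕ; solve-∀ to solve-∀ℕ)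
open import Data.Integer using (ℤ; +_; -[1+_]; 0ℤ; 1ℤ; -1ℤ; _⊖_; _^_)
  renaming (_+_ to _+ᶻ_; _*_ to _*ᶻ_; -_ to -ᶻ_; _-_ to _-ᶻ_)
import Data.Integer.Properties as ℤ
open import Data.Integer.Tactic.RingSolver
open import Data.Product using (Σ; _,_; proj₁; proj₂)
open import Data.Sum using (_⊎_; inj₁; inj₂)
open import Data.Empty using (⊥; ⊥-elim)
open import Function using (_∘_)
open import Data.List using ([]; _∷_; _∷ʳ_)
open import Data.List.Properties using (length-++)
open import Data.Bool using (true; false; if_then_else_)
open import Relation.Nullary using (¬_; yes; no)
open import Relation.Binary.Definitions using (tri<; tri≈; tri>)
open import Relation.Binary.PropositionalEquality
  using (refl; sym; trans; cong; cong₂; subst; subst₂; module ≡-Reasoning)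

±1-square : ∀ {σ} → σ ≡ 1ℤ ⊎ σ ≡ -1ℤ → σ *ᶻ σ ≡ 1ℤ
±1-square (inj₁ refl) = refl
±1-square (inj₂ refl) = refl

±1-cancel : ∀ {σ} → σ *ᶻ σ ≡ 1ℤ → ∀ g {a b} → g +ᶻ σ *ᶻ a ≡ g +ᶻ σ *ᶻ b → a ≡ b
±1-cancel {σ} σ²≡1 g {a} {b} eq = begin
  a                          ≡⟨ unit a ⟩
  σ *ᶻ σ *ᶻ a                ≡⟨ isolate g σ a ⟩
  σ *ᶻ (g +ᶻ σ *ᶻ a -ᶻ g)    ≡⟨ cong (λ z → σ *ᶻ (z -ᶻ g)) eq ⟩
  σ *ᶻ (g +ᶻ σ *ᶻ b -ᶻ g)    ≡⟨ isolate g σ b ⟨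
  σ *ᶻ σ *ᶻ b                ≡⟨ unit b ⟨
  b                          ∎
  where
  open ≡-Reasoning
  unit : ∀ x → x ≡ σ *ᶻ σ *ᶻ x
  unit x = trans (sym (ℤ.*-identityˡ x)) (cong (_*ᶻ x) (sym σ²≡1))
  isolate : ∀ g σ x → σ *ᶻ σ *ᶻ x ≡ σ *ᶻ (g +ᶻ σ *ᶻ x -ᶻ g)
  isolate = solve-∀

pos-affine : ∀ t r w → + (t + r * w) ≡ + t +ᶻ + r *ᶻ + w
pos-affine t r w = cong (+ t +ᶻ_) (ℤ.pos-* r w)

compose-offsets : ∀ {x w s} R m z → x -ᶻ R *ᶻ m ≡ w → w ≡ s +ᶻ R *ᶻ z → x ≡ s +ᶻ R *ᶻ (m +ᶻ z)
compose-offsets {x} {w} {s} R m z x-Rm≡w w≡s+Rz = begin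
  x                              ≡⟨ restore x R m ⟩
  x -ᶻ R *ᶻ m +ᶻ R *ᶻ m          ≡⟨ cong (_+ᶻ R *ᶻ m) (trans x-Rm≡w w≡s+Rz) ⟩
  s +ᶻ R *ᶻ z +ᶻ R *ᶻ m          ≡⟨ collect s R z m ⟩
  s +ᶻ R *ᶻ (m +ᶻ z)             ∎
  where
  open ≡-Reasoning
  restore : ∀ x R m → x ≡ x -ᶻ R *ᶻ m +ᶻ R *ᶻ m
  restore = solve-∀
  collect : ∀ s R z m → s +ᶻ R *ᶻ z +ᶻ R *ᶻ m ≡ s +ᶻ R *ᶻ (m +ᶻ z)
  collect = solve-∀

truncated-difference : ∀ m n → -ᶻ + (n ∸ m) +ᶻ + (m ∸ n) ≡ + m -ᶻ + n
truncated-difference m n with ℕ.≤-total m n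
... | inj₁ m≤n rewrite ℕ.m≤n⇒m∸n≡0 m≤n =
  trans (ℤ.+-identityʳ _) (sym (trans (ℤ.m-n≡m⊖n m n) (ℤ.⊖-≤ m≤n)))
... | inj₂ n≤m rewrite ℕ.m≤n⇒m∸n≡0 n≤m =
  sym (trans (ℤ.m-n≡m⊖n m n) (ℤ.⊖-≥ n≤m))

-- The ring ℤ[φ]: (a , b) stands for a + b φ.
Zφ : Set
Zφ = ℤ × ℤ

0φ : Zφ
0φ = 0ℤ , 0ℤ

infixl 6 _⊕_ _⊟_
infix  8 ⊝_
infixr 7 _⊛_
infixr 5 φ^_⊙_

_⊕_ : Zφ → Zφ → Zφ
(a , b) ⊕ (c , d) = a +ᶻ c , b +ᶻ d

⊝_ : Zφ → Zφ
⊝ (a , b) = -ᶻ a , -ᶻ b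

_⊟_ : Zφ → Zφ → Zφ
x ⊟ y = x ⊕ ⊝ y

_⊛_ : ℤ → Zφ → Zφ
c ⊛ (a , b) = c *ᶻ a , c *ᶻ b

-- φ (a + b φ) = b + (a + b) φ, as φ² = 1 + φ.
mulφ : Zφ → Zφ
mulφ (a , b) = b , a +ᶻ b

φ^_⊙_ : ℕ → Zφ → Zφ
φ^ zero  ⊙ x = x
φ^ suc k ⊙ x = φ^ k ⊙ mulφ x

mulφ-⊕ : ∀ x y → mulφ (x ⊕ y) ≡ mulφ x ⊕ mulφ y
mulφ-⊕ (a , b) (c , d) = cong (b +ᶻ d ,_) (interchange a c b d)
  where
  interchange : ∀ a c b d → a +ᶻ c +ᶻ (b +ᶻ d) ≡ a +ᶻ b +ᶻ (c +ᶻ d)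
  interchange = solve-∀

mulφ-⊝ : ∀ x → mulφ (⊝ x) ≡ ⊝ mulφ x
mulφ-⊝ (a , b) = cong (-ᶻ b ,_) (sym (ℤ.neg-distrib-+ a b))

mulφ-⊛ : ∀ c x → mulφ (c ⊛ x) ≡ c ⊛ mulφ x
mulφ-⊛ c (a , b) = cong (c *ᶻ b ,_) (sym (ℤ.*-distribˡ-+ c a b))

φ^-⊕ : ∀ k x y → φ^ k ⊙ (x ⊕ y) ≡ (φ^ k ⊙ x) ⊕ (φ^ k ⊙ y)
φ^-⊕ zero    x y = refl
φ^-⊕ (suc k) x y rewrite mulφ-⊕ x y = φ^-⊕ k (mulφ x) (mulφ y)

φ^-⊝ : ∀ k x → φ^ k ⊙ ⊝ x ≡ ⊝ (φ^ k ⊙ x)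
φ^-⊝ zero    x = refl
φ^-⊝ (suc k) x rewrite mulφ-⊝ x = φ^-⊝ k (mulφ x)

φ^-⊟ : ∀ k x y → φ^ k ⊙ (x ⊟ y) ≡ (φ^ k ⊙ x) ⊟ (φ^ k ⊙ y)
φ^-⊟ k x y = trans (φ^-⊕ k x (⊝ y)) (cong ((φ^ k ⊙ x) ⊕_) (φ^-⊝ k y))

φ^-⊛ : ∀ k c x → φ^ k ⊙ c ⊛ x ≡ c ⊛ (φ^ k ⊙ x)
φ^-⊛ zero    c x = refl
φ^-⊛ (suc k) c x rewrite mulφ-⊛ c x = φ^-⊛ k c (mulφ x)

φ^-mulφ : ∀ k x → φ^ k ⊙ mulφ x ≡ mulφ (φ^ k ⊙ x)
φ^-mulφ zero    x = refl
φ^-mulφ (suc k) x = φ^-mulφ k (mulφ x)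

φ^-+ : ∀ k j x → φ^ (k + j) ⊙ x ≡ φ^ j ⊙ φ^ k ⊙ x
φ^-+ zero    j x = refl
φ^-+ (suc k) j x = φ^-+ k j (mulφ x)

φ^-comm : ∀ k j x → φ^ k ⊙ φ^ j ⊙ x ≡ φ^ j ⊙ φ^ k ⊙ x
φ^-comm k j x = begin
  φ^ k ⊙ φ^ j ⊙ x   ≡⟨ φ^-+ j k x ⟨
  φ^ (j + k) ⊙ x    ≡⟨ cong (φ^_⊙ x) (ℕ.+-comm j k) ⟩
  φ^ (k + j) ⊙ x    ≡⟨ φ^-+ k j x ⟩
  φ^ j ⊙ φ^ k ⊙ x   ∎
  where open ≡-Reasoning

φ^-0φ : ∀ k → φ^ k ⊙ 0φ ≡ 0φ
φ^-0φ zero    = refl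
φ^-0φ (suc k) = φ^-0φ k

⊛-identityˡ : ∀ x → 1ℤ ⊛ x ≡ x
⊛-identityˡ (a , b) = cong₂ _,_ (ℤ.*-identityˡ a) (ℤ.*-identityˡ b)

-1⊛ : ∀ x → -1ℤ ⊛ x ≡ ⊝ x
-1⊛ (a , b) = cong₂ _,_ (ℤ.-1*i≡-i a) (ℤ.-1*i≡-i b)

-- x > 0 iff φᵏ x has non-negative coordinates, not both zero, for some k:
-- the ratio of the coordinates of φᵏ x tends to φ.
InQuadrant : Zφ → Set
InQuadrant (+ m     , + n)     = 0 < m + n
InQuadrant (+ m     , -[1+ n ]) = ⊥
InQuadrant (-[1+ m ] , _)       = ⊥

Positive : Zφ → Set
Positive x = ∃[ k ] InQuadrant (φ^ k ⊙ x)

NonNegative : Zφ → Set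
NonNegative x = Positive x ⊎ x ≡ 0φ

inQuadrant-mulφ : ∀ x → InQuadrant x → InQuadrant (mulφ x)
inQuadrant-mulφ (+ m , + n) 0<m+n = ℕ.<-≤-trans 0<m+n (ℕ.m≤n+m (m + n) n)

inQuadrant-φ^ : ∀ k x → InQuadrant x → InQuadrant (φ^ k ⊙ x)
inQuadrant-φ^ zero    x q = q
inQuadrant-φ^ (suc k) x q = inQuadrant-φ^ k (mulφ x) (inQuadrant-mulφ x q)

inQuadrant-⊕ : ∀ x y → InQuadrant x → InQuadrant y → InQuadrant (x ⊕ y)
inQuadrant-⊕ (+ m , + n) (+ m′ , + n′) p q =
  ℕ.<-≤-trans p (ℕ.+-mono-≤ (ℕ.m≤m+n m m′) (ℕ.m≤m+n n n′))

positive-φ^ : ∀ k {x} → Positive x → Positive (φ^ k ⊙ x)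
positive-φ^ k {x} (j , q) = j , subst InQuadrant (φ^-comm k j x) (inQuadrant-φ^ k _ q)

positive-unφ^ : ∀ k {x} → Positive (φ^ k ⊙ x) → Positive x
positive-unφ^ k {x} (j , q) = k + j , subst InQuadrant (sym (φ^-+ k j x)) q

positive-⊕ : ∀ {x y} → Positive x → Positive y → Positive (x ⊕ y)
positive-⊕ {x} {y} (k , p) (j , q) =
  k + j , subst InQuadrant (sym (φ^-⊕ (k + j) x y))
            (inQuadrant-⊕ _ _ (subst InQuadrant (sym (φ^-+ k j x)) (inQuadrant-φ^ j _ p))
                              (subst InQuadrant lift-y (inQuadrant-φ^ k _ q)))
  where
  lift-y : φ^ k ⊙ φ^ j ⊙ y ≡ φ^ (k + j) ⊙ y
  lift-y = trans (sym (φ^-+ j k y)) (cong (φ^_⊙ y) (ℕ.+-comm j k))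

nonNegative-⊕-positive : ∀ {x y} → NonNegative x → Positive y → Positive (x ⊕ y)
nonNegative-⊕-positive (inj₁ p)    q = positive-⊕ p q
nonNegative-⊕-positive {y = a , b} (inj₂ refl) q =
  subst Positive (sym (cong₂ _,_ (ℤ.+-identityˡ a) (ℤ.+-identityˡ b))) q

positive-⊕-nonNegative : ∀ {x y} → Positive x → NonNegative y → Positive (x ⊕ y)
positive-⊕-nonNegative {a , b} {c , d} p n =
  subst Positive (cong₂ _,_ (ℤ.+-comm c a) (ℤ.+-comm d b)) (nonNegative-⊕-positive n p)

¬positive-0φ : ¬ Positive 0φ
¬positive-0φ (k , q) rewrite φ^-0φ k = ℕ.<-irrefl refl q

positive-asym : ∀ {x} → Positive x → ¬ Positive (⊝ x)
positive-asym {x} (k , p) (j , q) =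
  opposite (φ^ (k + j) ⊙ x) (subst InQuadrant (sym (φ^-+ k j x)) (inQuadrant-φ^ j _ p))
    (subst InQuadrant negated (inQuadrant-φ^ k _ q))
  where
  opposite : ∀ y → InQuadrant y → ¬ InQuadrant (⊝ y)
  opposite (+ zero  , + zero)  () _
  opposite (+ zero  , + suc n) _ ()
  opposite (+ suc m , + n)     _ ()
  negated : φ^ k ⊙ φ^ j ⊙ ⊝ x ≡ ⊝ (φ^ (k + j) ⊙ x)
  negated = trans (φ^-comm k j (⊝ x)) (trans (sym (φ^-+ k j (⊝ x))) (φ^-⊝ (k + j) x))

positive-scale : ∀ n {x} → Positive x → Positive (+ suc n ⊛ x)
positive-scale zero    {a , b} p = subst Positive (sym (cong₂ _,_ (ℤ.*-identityˡ a) (ℤ.*-identityˡ b))) p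
positive-scale (suc n) {a , b} p =
  subst Positive (cong₂ _,_ (unfold (+ suc n) a) (unfold (+ suc n) b)) (positive-⊕ p (positive-scale n p))
  where
  unfold : ∀ c a → a +ᶻ c *ᶻ a ≡ (1ℤ +ᶻ c) *ᶻ a
  unfold = solve-∀

nonNegative-ℕ : ∀ n → NonNegative (+ n , 0ℤ)
nonNegative-ℕ zero    = inj₂ refl
nonNegative-ℕ (suc n) = inj₁ (0 , s≤s z≤n)

positive-integer : ∀ {z} → Positive (z , 0ℤ) → ∃[ n ] z ≡ + suc n
positive-integer {+ zero}   p = ⊥-elim (¬positive-0φ p)
positive-integer {+ suc n}  _ = n , refl
positive-integer { -[1+ n ]} p = ⊥-elim (positive-asym p (0 , s≤s z≤n))

positive-difference : ∀ a b → Positive (+ a -ᶻ + b , 0ℤ) → b < a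
positive-difference a b p with positive-integer p
... | n , eq = subst (b <_) (sym (ℤ.+-injective a≡b+n)) (ℕ.m<m+n b (s≤s z≤n))
  where
  a≡b+n : + a ≡ + b +ᶻ + suc n
  a≡b+n = trans (restore (+ a) (+ b)) (cong (+ b +ᶻ_) eq)
    where
    restore : ∀ a b → a ≡ b +ᶻ (a -ᶻ b)
    restore = solve-∀

-- By descent: if a + b φ has coordinates of opposite signs, then
-- φ (a + b φ) = b + (a + b) φ has coordinates of equal signs, or again of
-- opposite signs and then |b| < |a|.
Trichotomy : Zφ → Set
Trichotomy x = Positive x ⊎ Positive (⊝ x) ⊎ x ≡ 0φ

⊝-involutive : ∀ x → ⊝ ⊝ x ≡ x
⊝-involutive (a , b) = cong₂ _,_ (ℤ.neg-involutive a) (ℤ.neg-involutive b)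

trichotomy-⊝ : ∀ {x} → Trichotomy x → Trichotomy (⊝ x)
trichotomy-⊝ {x} (inj₁ p)        = inj₂ (inj₁ (subst Positive (sym (⊝-involutive x)) p))
trichotomy-⊝     (inj₂ (inj₁ p)) = inj₁ p
trichotomy-⊝     (inj₂ (inj₂ e)) = inj₂ (inj₂ (cong ⊝_ e))

mulφ-injective-0φ : ∀ x → mulφ x ≡ 0φ → x ≡ 0φ
mulφ-injective-0φ (a , b) e = cong₂ _,_ a≡0 b≡0
  where
  b≡0 = cong proj₁ e
  a≡0 = trans (sym (ℤ.+-identityʳ a)) (trans (cong (a +ᶻ_) (sym b≡0)) (cong proj₂ e))

trichotomy-unmulφ : ∀ {x} → Trichotomy (mulφ x) → Trichotomy x
trichotomy-unmulφ     (inj₁ p)        = inj₁ (positive-unφ^ 1 p)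
trichotomy-unmulφ {x} (inj₂ (inj₁ p)) = inj₂ (inj₁ (positive-unφ^ 1 (subst Positive (sym (mulφ-⊝ x)) p)))
trichotomy-unmulφ {x} (inj₂ (inj₂ e)) = inj₂ (inj₂ (mulφ-injective-0φ x e))

trichotomy-mixed : ∀ fuel m n → m < fuel → Trichotomy (+ m , -[1+ n ])
trichotomy-mixed (suc fuel) m n m<fuel with m ≤? n
... | yes m≤n = trichotomy-unmulφ (inj₂ (inj₁ (0 , negative)))
  where
  negative : InQuadrant (⊝ mulφ (+ m , -[1+ n ]))
  negative rewrite ℤ.⊖-< (s≤s m≤n) | ℕ.+-∸-assoc 1 m≤n = s≤s z≤n
... | no m≰n = trichotomy-unmulφ
  (subst (λ z → Trichotomy (-[1+ n ] , z)) (sym (ℤ.⊖-≥ (ℕ.≰⇒> m≰n))) (after (m ∸ suc n) refl))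
  where
  after : ∀ d → m ∸ suc n ≡ d → Trichotomy (-[1+ n ] , + d)
  after zero    _ = inj₂ (inj₁ (0 , s≤s z≤n))
  after (suc k) e = trichotomy-⊝ (trichotomy-mixed fuel (suc n) k 1+n<fuel)
    where
    1+n<fuel : suc n < fuel
    1+n<fuel = ℕ.<-≤-trans (ℕ.m∸n≢0⇒n<m (λ e′ → ℕ.0≢1+n (trans (sym e′) e))) (ℕ.≤-pred m<fuel)

trichotomy : ∀ x → Trichotomy x
trichotomy (+ zero    , + zero)    = inj₂ (inj₂ refl)
trichotomy (+ zero    , + suc n)   = inj₁ (0 , s≤s z≤n)
trichotomy (+ suc m   , + n)       = inj₁ (0 , s≤s z≤n)
trichotomy (-[1+ m ]  , -[1+ n ])  = inj₂ (inj₁ (0 , s≤s z≤n))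
trichotomy (-[1+ m ]  , + zero)    = inj₂ (inj₁ (0 , s≤s z≤n))
trichotomy (+ m       , -[1+ n ])  = trichotomy-mixed (suc m) m n ℕ.≤-refl
trichotomy (-[1+ m ]  , + suc n)   = trichotomy-⊝ (trichotomy-mixed (suc (suc m)) (suc m) n ℕ.≤-refl)

-- a + b φ > 0 with φ eliminated: for p > 0 and q ≥ 0, q > p φ iff
-- q² > q p + p², and q < p φ iff q² < q p + p².
PositiveCriterion : Zφ → Set
PositiveCriterion (+ m     , + n)      = 0 < m + n
PositiveCriterion (+ m     , -[1+ n ]) = m * suc n + suc n * suc n < m * m
PositiveCriterion (-[1+ m ] , + n)      = suc m * suc m < suc m * n + n * n
PositiveCriterion (-[1+ m ] , -[1+ n ]) = ⊥

criterion-unmulφ : ∀ x → PositiveCriterion (mulφ x) → PositiveCriterion x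
criterion-unmulφ (+ zero    , + zero)    ()
criterion-unmulφ (+ zero    , + suc n)   _ = s≤s z≤n
criterion-unmulφ (+ suc m   , + n)       _ = s≤s z≤n
criterion-unmulφ (-[1+ m ]  , -[1+ n ])  ()
criterion-unmulφ (+ m       , -[1+ n ])  c with m ≤? n
... | yes m≤n rewrite ℤ.⊖-< (s≤s m≤n) | ℕ.+-∸-assoc 1 m≤n = ⊥-elim c
... | no m≰n rewrite ℤ.⊖-≥ (ℕ.≰⇒> m≰n) =
  subst (λ m → m * suc n + suc n * suc n < m * m) (ℕ.m+[n∸m]≡n (ℕ.≰⇒> m≰n)) (widen (suc n) (m ∸ suc n) c)
  where
  widen : ∀ p k → p * p < p * k + k * k → (p + k) * p + p * p < (p + k) * (p + k)
  widen p k lt = subst ((p + k) * p + p * p <_) (expand p k) (ℕ.+-monoʳ-< ((p + k) * p) lt)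
    where
    expand : ∀ p k → (p + k) * p + (p * k + k * k) ≡ (p + k) * (p + k)
    expand = solve-∀ℕ
criterion-unmulφ (-[1+ m ]  , + n)       c with n ≤? m
... | no n≰m = ℕ.≤-<-trans (ℕ.*-monoʳ-≤ (suc m) (ℕ.≰⇒> n≰m)) (ℕ.m<m+n _ (ℕ.<-≤-trans (s≤s z≤n) (ℕ.*-mono-≤ (ℕ.≰⇒> n≰m) (ℕ.≰⇒> n≰m))))
... | yes n≤m rewrite ℤ.⊖-< (s≤s n≤m) | ℕ.+-∸-assoc 1 n≤m =
  subst (λ p → p * p < p * n + n * n) (trans (ℕ.+-suc n (m ∸ n)) (cong suc (ℕ.m+[n∸m]≡n n≤m))) (narrow n (suc (m ∸ n)) c)
  where
  narrow : ∀ n q → n * q + q * q < n * n → (n + q) * (n + q) < (n + q) * n + n * n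
  narrow n q lt = subst₂ _<_ (expandˡ n q) (expandʳ n q) (ℕ.+-monoˡ-< (n * n + n * q) lt)
    where
    expandˡ : ∀ n q → n * q + q * q + (n * n + n * q) ≡ (n + q) * (n + q)
    expandˡ = solve-∀ℕ
    expandʳ : ∀ n q → n * n + (n * n + n * q) ≡ (n + q) * n + n * n
    expandʳ = solve-∀ℕ

positive⇒criterion : ∀ {x} → Positive x → PositiveCriterion x
positive⇒criterion {x} (k , q) = descend k x q
  where
  descend : ∀ k x → InQuadrant (φ^ k ⊙ x) → PositiveCriterion x
  descend zero    (+ m , + n) q = q
  descend (suc k) x           q = criterion-unmulφ x (descend k (mulφ x) q)

discriminant-identity : ∀ a b c → b + c ≡ 2 * a → c * c + 4 * (a * b + b * b) ≡ 4 * (a * a) + 5 * (b * b)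
discriminant-identity a b c b+c≡2a = begin
  c * c + 4 * (a * b + b * b)            ≡⟨ solveℕ (a ∷ b ∷ c ∷ []) ⟩
  c * c + 2 * b * (2 * a) + 4 * (b * b)  ≡⟨ cong (λ z → c * c + 2 * b * z + 4 * (b * b)) (sym b+c≡2a) ⟩
  c * c + 2 * b * (b + c) + 4 * (b * b)  ≡⟨ solveℕ (b ∷ c ∷ []) ⟩
  (b + c) * (b + c) + 5 * (b * b)        ≡⟨ cong (λ z → z * z + 5 * (b * b)) b+c≡2a ⟩
  (2 * a) * (2 * a) + 5 * (b * b)        ≡⟨ solveℕ (a ∷ b ∷ []) ⟩
  4 * (a * a) + 5 * (b * b)              ∎
  where open ≡-Reasoning

square-criterion⇒<φ· : ∀ a b → a * a < a * b + b * b → a <φ· b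
square-criterion⇒<φ· a b lt with b ≤? 2 * a
... | yes b≤2a = ℕ.+-cancelʳ-< (4 * (a * b + b * b)) (c * c) (5 * (b * b)) (begin-strict
  c * c + 4 * (a * b + b * b)          ≡⟨ discriminant-identity a b c (ℕ.m+[n∸m]≡n b≤2a) ⟩
  4 * (a * a) + 5 * (b * b)            <⟨ ℕ.+-monoˡ-< (5 * (b * b)) (ℕ.*-monoʳ-< 4 lt) ⟩
  4 * (a * b + b * b) + 5 * (b * b)    ≡⟨ ℕ.+-comm (4 * (a * b + b * b)) (5 * (b * b)) ⟩
  5 * (b * b) + 4 * (a * b + b * b)    ∎)
  where
  open ℕ.≤-Reasoning
  c = 2 * a ∸ b
... | no b≰2a rewrite ℕ.m≤n⇒m∸n≡0 (ℕ.<⇒≤ (ℕ.≰⇒> b≰2a)) with b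
...   | zero  = ⊥-elim (b≰2a z≤n)
...   | suc _ = s≤s z≤n

square-criterion⇒φ·≤ : ∀ a b → a * b + b * b < a * a → φ· b ≤ a
square-criterion⇒φ·≤ a b lt with b ≤? 2 * a
... | yes b≤2a = ℕ.<⇒≤ (ℕ.+-cancelʳ-< (4 * (a * b + b * b)) (5 * (b * b)) (c * c) (begin-strict
  5 * (b * b) + 4 * (a * b + b * b)    ≡⟨ ℕ.+-comm (5 * (b * b)) (4 * (a * b + b * b)) ⟩
  4 * (a * b + b * b) + 5 * (b * b)    <⟨ ℕ.+-monoˡ-< (5 * (b * b)) (ℕ.*-monoʳ-< 4 lt) ⟩
  4 * (a * a) + 5 * (b * b)            ≡⟨ discriminant-identity a b c (ℕ.m+[n∸m]≡n b≤2a) ⟨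
  c * c + 4 * (a * b + b * b)          ∎))
  where
  open ℕ.≤-Reasoning
  c = 2 * a ∸ b
... | no b≰2a = ⊥-elim (ℕ.<-asym lt (ℕ.≤-<-trans (ℕ.*-monoʳ-≤ a a≤b) (ℕ.m<m+n (a * b) (ℕ.*-mono-≤ 0<b 0<b))))
  where
  a≤b : a ≤ b
  a≤b = ℕ.≤-trans (ℕ.m≤m+n a (a + 0)) (ℕ.<⇒≤ (ℕ.≰⇒> b≰2a))
  0<b : 0 < b
  0<b = ℕ.≤-<-trans z≤n (ℕ.≰⇒> b≰2a)

nonNegative⇒φ·≤ : ∀ a b → NonNegative (+ a , -ᶻ + b) → φ· b ≤ a
nonNegative⇒φ·≤ a zero    _        = z≤n
nonNegative⇒φ·≤ a (suc b) (inj₁ p) = square-criterion⇒φ·≤ a (suc b) (positive⇒criterion p)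

positive⇒<φ· : ∀ a b → Positive (-[1+ a ] , + b) → suc a <φ· b
positive⇒<φ· a b p = square-criterion⇒<φ· (suc a) b (positive⇒criterion p)

<φ·⇒positive : ∀ a b → a <φ· b → Positive (-ᶻ + a , + b)
<φ·⇒positive a b a<φb with trichotomy (-ᶻ + a , + b)
... | inj₁ p        = p
... | inj₂ (inj₁ p) =
  ⊥-elim (ℕ.<⇒≱ a<φb (nonNegative⇒φ·≤ a b (inj₁ (subst Positive (cong (_, -ᶻ + b) (ℤ.neg-involutive (+ a))) p))))
<φ·⇒positive zero    zero    a<φb | inj₂ (inj₂ _) = ⊥-elim (ℕ.<-irrefl refl a<φb)

φ : Zφ
φ = 0ℤ , 1ℤ

-- The graph of G: u = G v iff v + 1 - u φ ≥ 0 and (u + 1) φ - (v + 1) > 0.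
lowerGap upperGap : ℤ → ℤ → Zφ
lowerGap u v = v +ᶻ 1ℤ , -ᶻ u
upperGap u v = -ᶻ (v +ᶻ 1ℤ) , u +ᶻ 1ℤ

IsGφ : ℤ → ℤ → Set
IsGφ u v = NonNegative (lowerGap u v) × Positive (upperGap u v)

isGφ⇒IsG : ∀ u v → IsGφ (+ u) (+ v) → IsG u v
isGφ⇒IsG u v (lower , upper) =
  nonNegative⇒φ·≤ (v + 1) u lower ,
  subst (_<φ· (u + 1)) (ℕ.+-comm 1 v)
    (positive⇒<φ· v (u + 1) (subst (λ z → Positive (-ᶻ + z , + (u + 1))) (ℕ.+-comm v 1) upper))

lowerGap-shift : ∀ u v p q → lowerGap (u +ᶻ p) (v +ᶻ q) ≡ lowerGap u v ⊕ (q , -ᶻ p)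
lowerGap-shift u v p q = cong₂ _,_ (shuffle v q) (ℤ.neg-distrib-+ u p)
  where
  shuffle : ∀ v q → v +ᶻ q +ᶻ 1ℤ ≡ v +ᶻ 1ℤ +ᶻ q
  shuffle = solve-∀

upperGap-shift : ∀ u v p q → upperGap (u +ᶻ p) (v +ᶻ q) ≡ upperGap u v ⊟ (q , -ᶻ p)
upperGap-shift u v p q = cong₂ _,_ (shuffleˡ v q) (shuffleʳ u p)
  where
  shuffleˡ : ∀ v q → -ᶻ (v +ᶻ q +ᶻ 1ℤ) ≡ -ᶻ (v +ᶻ 1ℤ) +ᶻ -ᶻ q
  shuffleˡ = solve-∀
  shuffleʳ : ∀ u p → u +ᶻ p +ᶻ 1ℤ ≡ u +ᶻ 1ℤ +ᶻ -ᶻ (-ᶻ p)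
  shuffleʳ = solve-∀

lowerGap-suc : ∀ u v → lowerGap (u +ᶻ 1ℤ) v ≡ ⊝ upperGap u v
lowerGap-suc u v = cong (_, -ᶻ (u +ᶻ 1ℤ)) (sym (ℤ.neg-involutive (v +ᶻ 1ℤ)))

isGφ-shift⁺ : ∀ {u v} p q → IsGφ u v → Positive (q , -ᶻ p) → Positive (φ ⊟ (q , -ᶻ p)) →
              IsGφ (u +ᶻ p) (v +ᶻ q) ⊎ IsGφ (u +ᶻ p +ᶻ 1ℤ) (v +ᶻ q)
isGφ-shift⁺ {u} {v} p q (lower , upper) d>0 φ-d>0 = settle (trichotomy (upperGap (u +ᶻ p) (v +ᶻ q)))
  where
  lower′ : Positive (lowerGap (u +ᶻ p) (v +ᶻ q))
  lower′ = subst Positive (sym (lowerGap-shift u v p q)) (nonNegative-⊕-positive lower d>0)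
  upper″ : Positive (upperGap (u +ᶻ p +ᶻ 1ℤ) (v +ᶻ q))
  upper″ = subst Positive (cong₂ _,_ (shuffleˡ v q) (shuffleʳ u p)) (positive-⊕ upper φ-d>0)
    where
    shuffleˡ : ∀ v q → -ᶻ (v +ᶻ 1ℤ) +ᶻ (0ℤ +ᶻ -ᶻ q) ≡ -ᶻ (v +ᶻ q +ᶻ 1ℤ)
    shuffleˡ = solve-∀
    shuffleʳ : ∀ u p → u +ᶻ 1ℤ +ᶻ (1ℤ +ᶻ -ᶻ (-ᶻ p)) ≡ u +ᶻ p +ᶻ 1ℤ +ᶻ 1ℤ
    shuffleʳ = solve-∀
  settle : Trichotomy (upperGap (u +ᶻ p) (v +ᶻ q)) → IsGφ (u +ᶻ p) (v +ᶻ q) ⊎ IsGφ (u +ᶻ p +ᶻ 1ℤ) (v +ᶻ q)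
  settle (inj₁ upper′)        = inj₁ (inj₁ lower′ , upper′)
  settle (inj₂ (inj₁ upper′<0)) = inj₂ (inj₁ (subst Positive (sym (lowerGap-suc (u +ᶻ p) (v +ᶻ q))) upper′<0) , upper″)
  settle (inj₂ (inj₂ upper′≡0)) = inj₂ (inj₂ (trans (lowerGap-suc (u +ᶻ p) (v +ᶻ q)) (cong ⊝_ upper′≡0)) , upper″)

isGφ-shift⁻ : ∀ {u v} p q → IsGφ u v → Positive (⊝ (q , -ᶻ p)) → Positive (φ ⊕ (q , -ᶻ p)) →
              IsGφ (u +ᶻ p) (v +ᶻ q) ⊎ IsGφ (u +ᶻ p +ᶻ -1ℤ) (v +ᶻ q)
isGφ-shift⁻ {u} {v} p q (lower , upper) d<0 φ+d>0 = settle (trichotomy (lowerGap (u +ᶻ p) (v +ᶻ q)))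
  where
  upper′ : Positive (upperGap (u +ᶻ p) (v +ᶻ q))
  upper′ = subst Positive (sym (upperGap-shift u v p q)) (positive-⊕ upper d<0)
  lower″ : Positive (lowerGap (u +ᶻ p +ᶻ -1ℤ) (v +ᶻ q))
  lower″ = subst Positive (cong₂ _,_ (shuffleˡ v q) (shuffleʳ u p)) (nonNegative-⊕-positive lower φ+d>0)
    where
    shuffleˡ : ∀ v q → v +ᶻ 1ℤ +ᶻ (0ℤ +ᶻ q) ≡ v +ᶻ q +ᶻ 1ℤ
    shuffleˡ = solve-∀
    shuffleʳ : ∀ u p → -ᶻ u +ᶻ (1ℤ +ᶻ -ᶻ p) ≡ -ᶻ (u +ᶻ p +ᶻ -1ℤ)
    shuffleʳ = solve-∀
  settle : Trichotomy (lowerGap (u +ᶻ p) (v +ᶻ q)) → IsGφ (u +ᶻ p) (v +ᶻ q) ⊎ IsGφ (u +ᶻ p +ᶻ -1ℤ) (v +ᶻ q)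
  settle (inj₁ lower′)          = inj₁ (inj₁ lower′ , upper′)
  settle (inj₂ (inj₂ lower′≡0)) = inj₁ (inj₂ lower′≡0 , upper′)
  settle (inj₂ (inj₁ lower′<0)) =
    inj₂ (inj₁ lower″ , subst Positive (cong (-ᶻ (v +ᶻ q +ᶻ 1ℤ) ,_) (cancel (u +ᶻ p))) lower′<0)
    where
    cancel : ∀ w → -ᶻ (-ᶻ w) ≡ w +ᶻ -1ℤ +ᶻ 1ℤ
    cancel = solve-∀

-- Adding (p , q) to a point (u , v) of the graph of G moves v + 1 - u φ by
-- d = q - p φ; if 0 < σ d < φ the new point is on the graph after
-- correcting u by 0 or σ.
isGφ-shift : ∀ σ → σ ≡ 1ℤ ⊎ σ ≡ -1ℤ → ∀ {u v} p q → IsGφ u v →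
             Positive (σ ⊛ (q , -ᶻ p)) → Positive (φ ⊟ σ ⊛ (q , -ᶻ p)) →
             IsGφ (u +ᶻ p) (v +ᶻ q) ⊎ IsGφ (u +ᶻ p +ᶻ σ) (v +ᶻ q)
isGφ-shift .1ℤ (inj₁ refl) {u} {v} p q g σd>0 φ-σd>0 =
  isGφ-shift⁺ {u} {v} p q g (subst Positive (⊛-identityˡ _) σd>0)
                    (subst (λ z → Positive (φ ⊟ z)) (⊛-identityˡ (q , -ᶻ p)) φ-σd>0)
isGφ-shift .-1ℤ (inj₂ refl) {u} {v} p q g σd>0 φ-σd>0 =
  isGφ-shift⁻ {u} {v} p q g (subst Positive (-1⊛ _) σd>0)
                    (subst (λ z → Positive (φ ⊕ z)) (trans (cong ⊝_ (-1⊛ (q , -ᶻ p))) (⊝-involutive _)) φ-σd>0)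

¬positive-[1⊖1+n]φ : ∀ n → ¬ Positive (0ℤ , 1 ⊖ suc n)
¬positive-[1⊖1+n]φ zero    = ¬positive-0φ
¬positive-[1⊖1+n]φ (suc k) = positive-asym {0ℤ , + suc k} (0 , s≤s z≤n)

unit-window : ∀ d → Positive (0ℤ , 1ℤ +ᶻ d) → Positive (0ℤ , 1ℤ +ᶻ -ᶻ d) → d ≡ 0ℤ
unit-window (+ zero)  _ _ = refl
unit-window (+ suc n) _ q = ⊥-elim (¬positive-[1⊖1+n]φ n q)
unit-window -[1+ n ]  p _ = ⊥-elim (¬positive-[1⊖1+n]φ n p)

gaps-sum : ∀ u u′ v → lowerGap u′ v ⊕ upperGap u v ≡ (0ℤ , 1ℤ +ᶻ (u -ᶻ u′))
gaps-sum u u′ v = cong₂ _,_ (ℤ.+-inverseʳ (v +ᶻ 1ℤ)) (rearrange u u′)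
  where
  rearrange : ∀ u u′ → -ᶻ u′ +ᶻ (u +ᶻ 1ℤ) ≡ 1ℤ +ᶻ (u -ᶻ u′)
  rearrange = solve-∀

isGφ-unique : ∀ {u u′ v} → IsGφ u v → IsGφ u′ v → u ≡ u′
isGφ-unique {u} {u′} {v} (lower , upper) (lower′ , upper′) =
  ℤ.i-j≡0⇒i≡j u u′ (unit-window (u -ᶻ u′) gap gap′)
  where
  gap : Positive (0ℤ , 1ℤ +ᶻ (u -ᶻ u′))
  gap = subst Positive (gaps-sum u u′ v) (nonNegative-⊕-positive lower′ upper)
  gap′ : Positive (0ℤ , 1ℤ +ᶻ -ᶻ (u -ᶻ u′))
  gap′ = subst Positive (trans (gaps-sum u′ u v) (cong (λ z → 0ℤ , 1ℤ +ᶻ z) (swap u u′)))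
                        (nonNegative-⊕-positive lower upper′)
    where
    swap : ∀ u u′ → u′ -ᶻ u ≡ -ᶻ (u -ᶻ u′)
    swap = solve-∀

G-exists : ∀ v → ∃[ g ] (IsGφ (+ g) (+ v) × g ≤ v)
G-exists zero = 0 , (inj₁ (0 , s≤s z≤n) , (1 , s≤s z≤n)) , z≤n
G-exists (suc v) with G-exists v
... | g , isG , g≤v with isGφ-shift⁺ {+ g} {+ v} 0ℤ 1ℤ isG (0 , s≤s z≤n) (1 , s≤s z≤n)
... | inj₁ isG′ = g , subst₂ IsGφ (ℤ.+-identityʳ (+ g)) (cong +_ (ℕ.+-comm v 1)) isG′ , ℕ.m≤n⇒m≤1+n g≤v
... | inj₂ isG′ = suc g , subst₂ IsGφ (cong +_ (trans (cong (_+ 1) (ℕ.+-identityʳ g)) (ℕ.+-comm g 1))) (cong +_ (ℕ.+-comm v 1)) isG′ , s≤s g≤v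

G-positive : ∀ {u v} → 0 < v → IsGφ (+ u) (+ v) → 0 < u
G-positive {suc u}               _ _           = s≤s z≤n
G-positive {zero}  {suc v}       _ (_ , upper) =
  ⊥-elim (ℕ.<⇒≱ (positive⇒criterion upper) (subst (bound ≤_) (expand v) (ℕ.m≤m+n bound (v * v + 3 * v + 1))))
  where
  bound = suc (v + 1) * (0 + 1) + (0 + 1) * (0 + 1)
  expand : ∀ v → suc (v + 1) * (0 + 1) + (0 + 1) * (0 + 1) + (v * v + 3 * v + 1) ≡ suc (v + 1) * suc (v + 1)
  expand = solve-∀ℕ

-- Fibonacci numbers in ℤ[φ]

F-positive : ∀ k → 0 < F (suc k)
F-positive zero    = s≤s z≤n
F-positive (suc k) = ℕ.≤-trans (F-positive k) (ℕ.m≤m+n _ _)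

F-+ : ∀ m n → F (suc (m + n)) ≡ F (suc m) * F (suc n) + F m * F n
F-+ zero    n = sym (trans (ℕ.+-identityʳ (1 * F (suc n))) (ℕ.*-identityˡ (F (suc n))))
F-+ (suc m) n = begin
  F (suc (suc m + n))                                       ≡⟨ cong (λ k → F (suc k)) (ℕ.+-suc m n) ⟨
  F (suc (m + suc n))                                       ≡⟨ F-+ m (suc n) ⟩
  F (suc m) * F (suc (suc n)) + F m * F (suc n)             ≡⟨ regroup (F (suc m)) (F m) (F (suc n)) (F n) ⟩
  (F (suc m) + F m) * F (suc n) + F (suc m) * F n           ∎
  where
  open ≡-Reasoning
  regroup : ∀ a b c d → a * (c + d) + b * c ≡ (a + b) * c + a * d
  regroup = solve-∀ℕ

3≤F-even : ∀ k → -1ℤ ^ suc k ≡ 1ℤ → 3 ≤ F (3 + k)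
3≤F-even zero    ()
3≤F-even (suc k) _ = ℕ.+-mono-≤ (ℕ.+-mono-≤ (F-positive (suc k)) (F-positive k)) (F-positive (suc k))

cassini : ∀ k → + F (suc k) *ᶻ + F (suc k) -ᶻ + F (suc k) *ᶻ + F k -ᶻ + F k *ᶻ + F k ≡ -1ℤ ^ k
cassini zero    = refl
cassini (suc k) = begin
  (a +ᶻ b) *ᶻ (a +ᶻ b) -ᶻ (a +ᶻ b) *ᶻ a -ᶻ a *ᶻ a  ≡⟨ flip a b ⟩
  -ᶻ (a *ᶻ a -ᶻ a *ᶻ b -ᶻ b *ᶻ b)                  ≡⟨ cong -ᶻ_ (cassini k) ⟩
  -ᶻ (-1ℤ ^ k)                                     ≡⟨ ℤ.-1*i≡-i (-1ℤ ^ k) ⟨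
  -1ℤ ^ suc k                                      ∎
  where
  open ≡-Reasoning
  a = + F (suc k)
  b = + F k
  flip : ∀ a b → (a +ᶻ b) *ᶻ (a +ᶻ b) -ᶻ (a +ᶻ b) *ᶻ a -ᶻ a *ᶻ a ≡ -ᶻ (a *ᶻ a -ᶻ a *ᶻ b -ᶻ b *ᶻ b)
  flip = solve-∀

-1^-cases : ∀ k → -1ℤ ^ k ≡ 1ℤ ⊎ -1ℤ ^ k ≡ -1ℤ
-1^-cases zero = inj₁ refl
-1^-cases (suc k) with -1^-cases k
... | inj₁ e = inj₂ (cong (-1ℤ *ᶻ_) e)
... | inj₂ e = inj₁ (cong (-1ℤ *ᶻ_) e)


φ^-φ : ∀ k → φ^ k ⊙ φ ≡ (+ F k , + F (suc k))
φ^-φ zero    = refl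
φ^-φ (suc k) = begin
  φ^ k ⊙ mulφ φ                   ≡⟨ φ^-mulφ k φ ⟩
  mulφ (φ^ k ⊙ φ)                 ≡⟨ cong mulφ (φ^-φ k) ⟩
  (+ F (suc k) , + (F k + F (suc k)))  ≡⟨ cong (λ z → + F (suc k) , + z) (ℕ.+-comm (F k) (F (suc k))) ⟩
  (+ F (suc k) , + F (suc (suc k)))    ∎
  where open ≡-Reasoning

-- ψᵏ = F (k + 1) - F k φ for the conjugate ψ = 1 - φ = -1/φ.
ψ^ : ℕ → Zφ
ψ^ k = + F (suc k) , -ᶻ + F k

mulφ-ψ^ : ∀ k → mulφ (ψ^ (suc k)) ≡ ⊝ ψ^ k
mulφ-ψ^ k = cong (-ᶻ + F (suc k) ,_) (cancel (+ F (suc k)) (+ F k))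
  where
  cancel : ∀ a b → a +ᶻ b +ᶻ -ᶻ a ≡ -ᶻ (-ᶻ b)
  cancel = solve-∀

φ^-ψ^ : ∀ k → φ^ k ⊙ ψ^ k ≡ (-1ℤ ^ k , 0ℤ)
φ^-ψ^ zero    = refl
φ^-ψ^ (suc k) = begin
  φ^ k ⊙ mulφ (ψ^ (suc k))   ≡⟨ cong (φ^ k ⊙_) (mulφ-ψ^ k) ⟩
  φ^ k ⊙ ⊝ ψ^ k              ≡⟨ φ^-⊝ k (ψ^ k) ⟩
  ⊝ (φ^ k ⊙ ψ^ k)            ≡⟨ cong ⊝_ (φ^-ψ^ k) ⟩
  (-ᶻ (-1ℤ ^ k) , 0ℤ)        ≡⟨ cong (_, 0ℤ) (ℤ.-1*i≡-i (-1ℤ ^ k)) ⟨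
  (-1ℤ ^ suc k , 0ℤ)         ∎
  where open ≡-Reasoning

positive-ψ^ : ∀ k → Positive (-1ℤ ^ k ⊛ ψ^ k)
positive-ψ^ k = k , subst InQuadrant (sym unit) (s≤s z≤n)
  where
  unit : φ^ k ⊙ -1ℤ ^ k ⊛ ψ^ k ≡ (1ℤ , 0ℤ)
  unit = trans (φ^-⊛ k (-1ℤ ^ k) (ψ^ k))
        (trans (cong (-1ℤ ^ k ⊛_) (φ^-ψ^ k)) (cong₂ _,_ (±1-square (-1^-cases k)) (ℤ.*-zeroʳ (-1ℤ ^ k))))

counter-takes-values : (c : ℕ → ℕ) → c 0 ≡ 0 → (∀ k → c (suc k) ≡ c k ⊎ c (suc k) ≡ suc (c k)) →
                       ∀ K j → j ≤ c K → ∃[ k ] c k ≡ j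
counter-takes-values c c0≡0 steps zero j j≤c0 = 0 , trans c0≡0 (sym (ℕ.n≤0⇒n≡0 (subst (j ≤_) c0≡0 j≤c0)))
counter-takes-values c c0≡0 steps (suc K) j j≤cK′ with j ≤? c K
... | yes j≤cK = counter-takes-values c c0≡0 steps K j j≤cK
... | no j≰cK with steps K
...   | inj₁ e = ⊥-elim (j≰cK (subst (j ≤_) e j≤cK′))
...   | inj₂ e = suc K , ℕ.≤-antisym (subst (_≤ j) (sym e) (ℕ.≰⇒> j≰cK)) j≤cK′

division-unique : ∀ n q y a → y < n → n * q + y ≡ n * a → q ≡ a × y ≡ 0
division-unique n q y a y<n eq with ℕ.<-cmp q a
... | tri< q<a _ _ = ⊥-elim (ℕ.<-irrefl eq (begin-strict
  n * q + y    <⟨ ℕ.+-monoʳ-< (n * q) y<n ⟩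
  n * q + n    ≡⟨ ℕ.+-comm (n * q) n ⟩
  n + n * q    ≡⟨ ℕ.*-suc n q ⟨
  n * suc q    ≤⟨ ℕ.*-monoʳ-≤ n q<a ⟩
  n * a        ∎))
  where open ℕ.≤-Reasoning
... | tri> _ _ a<q = ⊥-elim (ℕ.<-irrefl (sym eq) (begin-strict
  n * a        <⟨ ℕ.m<m+n (n * a) (ℕ.≤-<-trans z≤n y<n) ⟩
  n * a + n    ≡⟨ ℕ.+-comm (n * a) n ⟩
  n + n * a    ≡⟨ ℕ.*-suc n a ⟨
  n * suc a    ≤⟨ ℕ.*-monoʳ-≤ n a<q ⟩
  n * q        ≤⟨ ℕ.m≤m+n (n * q) y ⟩
  n * q + y    ∎))
  where open ℕ.≤-Reasoning
... | tri≈ _ refl _ = refl , ℕ.+-cancelˡ-≡ (n * q) y 0 (trans eq (sym (ℕ.+-identityʳ (n * q))))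

-- Visiting y = k A mod (A + B) for k = 0, 1, …, the point t + r y moves by
-- r A or by -r B, which moves v + 1 - u φ by r (A - B φ) or r (C φ - B).
-- Both have sign σ and size below φ, so G (t + r y) - r (k B - ⌊k A/N⌋ A)
-- follows g₀ + σ c with a counter c growing by 0 or 1; after N = A + B
-- steps the walk is back at y = 0 and Cassini's identity gives c = r.
module Walk (r B C : ℕ) where

  A N : ℕ
  A = B + C
  N = A + B

  up-step down-step : Zφ
  up-step   = + r *ᶻ + A , -ᶻ (+ r *ᶻ + B)
  down-step = -ᶻ (+ r *ᶻ + B) , -ᶻ (-ᶻ (+ r *ᶻ + C))

  drift : ℕ → ℕ → ℤ
  drift k laps = + (k * B) -ᶻ + (laps * A)

  module Run (t g₀ : ℕ) (σ : ℤ) (σ≡±1 : σ ≡ 1ℤ ⊎ σ ≡ -1ℤ) (0<B : 0 < B)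
             (g₀≡Gt : IsGφ (+ g₀) (+ t))
             (cassini-AB : drift N A ≡ -ᶻ σ)
             (up>0 : Positive (σ ⊛ up-step)) (up<φ : Positive (φ ⊟ σ ⊛ up-step))
             (down>0 : Positive (σ ⊛ down-step)) (down<φ : Positive (φ ⊟ σ ⊛ down-step)) where

    origin : t + r * 0 ≡ t
    origin = trans (cong (_+_ t) (ℕ.*-zeroʳ r)) (ℕ.+-identityʳ t)

    record Visit (k : ℕ) : Set where
      constructor visit
      field
        y laps c : ℕ
        g        : ℤ
        y<N      : y < N
        division : N * laps + y ≡ k * A
        on-graph : IsGφ g (+ (t + r * y))
        tracks   : g -ᶻ + r *ᶻ drift k laps ≡ + g₀ +ᶻ σ *ᶻ + c
    open Visit

    Advance : ∀ {k} → Visit k → Visit (suc k) → Set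
    Advance v w = c w ≡ c v ⊎ c w ≡ suc (c v)

    settle : ∀ {k} (v : Visit k) y′ laps′ (p q : ℤ) → y′ < N → N * laps′ + y′ ≡ suc k * A →
             + (t + r * y v) +ᶻ q ≡ + (t + r * y′) →
             g v +ᶻ p -ᶻ + r *ᶻ drift (suc k) laps′ ≡ g v -ᶻ + r *ᶻ drift k (laps v) →
             IsGφ (g v +ᶻ p) (+ (t + r * y v) +ᶻ q) ⊎ IsGφ (g v +ᶻ p +ᶻ σ) (+ (t + r * y v) +ᶻ q) →
             Σ (Visit (suc k)) (Advance v)
    settle v y′ laps′ p q y′<N div moved balance (inj₁ on) =
      visit y′ laps′ (c v) (g v +ᶻ p) y′<N div (subst (IsGφ _) moved on) (trans balance (tracks v)) , inj₁ refl
    settle {k} v y′ laps′ p q y′<N div moved balance (inj₂ on) =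
      visit y′ laps′ (suc (c v)) (g v +ᶻ p +ᶻ σ) y′<N div (subst (IsGφ _) moved on) tracks′ , inj₂ refl
      where
      tracks′ : g v +ᶻ p +ᶻ σ -ᶻ + r *ᶻ drift (suc k) laps′ ≡ + g₀ +ᶻ σ *ᶻ + suc (c v)
      tracks′ = begin
        g v +ᶻ p +ᶻ σ -ᶻ + r *ᶻ drift (suc k) laps′      ≡⟨ swap (g v +ᶻ p) σ (+ r *ᶻ drift (suc k) laps′) ⟩
        g v +ᶻ p -ᶻ + r *ᶻ drift (suc k) laps′ +ᶻ σ      ≡⟨ cong (_+ᶻ σ) (trans balance (tracks v)) ⟩
        + g₀ +ᶻ σ *ᶻ + c v +ᶻ σ                           ≡⟨ absorb (+ g₀) σ (+ c v) ⟩
        + g₀ +ᶻ σ *ᶻ + suc (c v)                          ∎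
        where
        open ≡-Reasoning
        swap : ∀ x σ y → x +ᶻ σ -ᶻ y ≡ x -ᶻ y +ᶻ σ
        swap = solve-∀
        absorb : ∀ g σ c → g +ᶻ σ *ᶻ c +ᶻ σ ≡ g +ᶻ σ *ᶻ (1ℤ +ᶻ c)
        absorb = solve-∀

    step-up : ∀ {k} (v : Visit k) → y v < B → Σ (Visit (suc k)) (Advance v)
    step-up {k} v y<B =
      settle v (y v + A) (laps v) (+ r *ᶻ + B) (+ r *ᶻ + A) y+A<N div moved balance
        (isGφ-shift σ σ≡±1 {g v} {+ (t + r * y v)} (+ r *ᶻ + B) (+ r *ᶻ + A) (on-graph v) up>0 up<φ)
      where
      y+A<N : y v + A < N
      y+A<N = subst (y v + A <_) (ℕ.+-comm B A) (ℕ.+-monoˡ-< A y<B)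
      div : N * laps v + (y v + A) ≡ suc k * A
      div = trans (sym (ℕ.+-assoc (N * laps v) (y v) A)) (trans (cong (_+ A) (division v)) (ℕ.+-comm (k * A) A))
      moved : + (t + r * y v) +ᶻ + r *ᶻ + A ≡ + (t + r * (y v + A))
      moved = begin
        + (t + r * y v) +ᶻ + r *ᶻ + A          ≡⟨ cong (_+ᶻ + r *ᶻ + A) (pos-affine t r (y v)) ⟩
        + t +ᶻ + r *ᶻ + y v +ᶻ + r *ᶻ + A      ≡⟨ distrib (+ t) (+ r) (+ y v) (+ A) ⟩
        + t +ᶻ + r *ᶻ + (y v + A)              ≡⟨ pos-affine t r (y v + A) ⟨
        + (t + r * (y v + A))                  ∎
        where
        open ≡-Reasoning
        distrib : ∀ t r y a → t +ᶻ r *ᶻ y +ᶻ r *ᶻ a ≡ t +ᶻ r *ᶻ (y +ᶻ a)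
        distrib = solve-∀
      balance : g v +ᶻ + r *ᶻ + B -ᶻ + r *ᶻ drift (suc k) (laps v) ≡ g v -ᶻ + r *ᶻ drift k (laps v)
      balance = cancel (g v) (+ r) (+ B) (+ (k * B)) (+ (laps v * A))
        where
        cancel : ∀ g R b kb la → g +ᶻ R *ᶻ b -ᶻ R *ᶻ (b +ᶻ kb -ᶻ la) ≡ g -ᶻ R *ᶻ (kb -ᶻ la)
        cancel = solve-∀

    step-down : ∀ {k} (v : Visit k) → B ≤ y v → Σ (Visit (suc k)) (Advance v)
    step-down {k} v B≤y =
      settle v (y v ∸ B) (suc (laps v)) (-ᶻ (+ r *ᶻ + C)) (-ᶻ (+ r *ᶻ + B)) y-B<N div moved balance
        (isGφ-shift σ σ≡±1 {g v} {+ (t + r * y v)} (-ᶻ (+ r *ᶻ + C)) (-ᶻ (+ r *ᶻ + B)) (on-graph v) down>0 down<φ)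
      where
      y-B<N : y v ∸ B < N
      y-B<N = ℕ.≤-<-trans (ℕ.m∸n≤m (y v) B) (y<N v)
      div : N * suc (laps v) + (y v ∸ B) ≡ suc k * A
      div = begin
        N * suc (laps v) + (y v ∸ B)          ≡⟨ regroup A B (laps v) (y v ∸ B) ⟩
        A + (N * laps v + (B + (y v ∸ B)))    ≡⟨ cong (λ z → A + (N * laps v + z)) (ℕ.m+[n∸m]≡n B≤y) ⟩
        A + (N * laps v + y v)                ≡⟨ cong (_+_ A) (division v) ⟩
        suc k * A                             ∎
        where
        open ≡-Reasoning
        regroup : ∀ a b l z → (a + b) * suc l + z ≡ a + ((a + b) * l + (b + z))
        regroup = solve-∀ℕ
      moved : + (t + r * y v) +ᶻ -ᶻ (+ r *ᶻ + B) ≡ + (t + r * (y v ∸ B))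
      moved = begin
        + (t + r * y v) +ᶻ -ᶻ (+ r *ᶻ + B)                  ≡⟨ cong (λ z → + (t + r * z) +ᶻ -ᶻ (+ r *ᶻ + B)) (ℕ.m+[n∸m]≡n B≤y) ⟨
        + (t + r * (B + (y v ∸ B))) +ᶻ -ᶻ (+ r *ᶻ + B)      ≡⟨ cong (_+ᶻ -ᶻ (+ r *ᶻ + B)) (pos-affine t r (B + (y v ∸ B))) ⟩
        + t +ᶻ + r *ᶻ (+ B +ᶻ + (y v ∸ B)) +ᶻ -ᶻ (+ r *ᶻ + B) ≡⟨ cancel (+ t) (+ r) (+ B) (+ (y v ∸ B)) ⟩
        + t +ᶻ + r *ᶻ + (y v ∸ B)                            ≡⟨ pos-affine t r (y v ∸ B) ⟨
        + (t + r * (y v ∸ B))                               ∎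
        where
        open ≡-Reasoning
        cancel : ∀ t r b z → t +ᶻ r *ᶻ (b +ᶻ z) +ᶻ -ᶻ (r *ᶻ b) ≡ t +ᶻ r *ᶻ z
        cancel = solve-∀
      balance : g v +ᶻ -ᶻ (+ r *ᶻ + C) -ᶻ + r *ᶻ drift (suc k) (suc (laps v)) ≡ g v -ᶻ + r *ᶻ drift k (laps v)
      balance = cancel (g v) (+ r) (+ B) (+ C) (+ (k * B)) (+ (laps v * A))
        where
        cancel : ∀ g R b c kb la → g +ᶻ -ᶻ (R *ᶻ c) -ᶻ R *ᶻ (b +ᶻ kb -ᶻ (b +ᶻ c +ᶻ la)) ≡ g -ᶻ R *ᶻ (kb -ᶻ la)
        cancel = solve-∀

    step : ∀ {k} (v : Visit k) → Σ (Visit (suc k)) (Advance v)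
    step v with y v <? B
    ... | yes y<B = step-up v y<B
    ... | no y≮B  = step-down v (ℕ.≮⇒≥ y≮B)

    start : Visit 0
    start = visit 0 0 0 (+ g₀) (ℕ.<-≤-trans 0<B (ℕ.m≤n+m B A))
                  (trans (ℕ.+-identityʳ (N * 0)) (ℕ.*-zeroʳ N))
                  (subst (λ z → IsGφ (+ g₀) (+ z)) (sym origin) g₀≡Gt)
                  (vanish (+ g₀) (+ r) σ)
      where
      vanish : ∀ g R σ → g -ᶻ R *ᶻ 0ℤ ≡ g +ᶻ σ *ᶻ 0ℤ
      vanish = solve-∀

    walk : ∀ k → Visit k
    walk zero    = start
    walk (suc k) = proj₁ (step (walk k))

    σ²≡1 : σ *ᶻ σ ≡ 1ℤ
    σ²≡1 = ±1-square σ≡±1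

    returns : c (walk N) ≡ r
    returns with walk N
    ... | visit y laps c g y<N div on tr with division-unique N laps y A y<N div
    ...   | refl , refl = sym (ℤ.+-injective (±1-cancel {σ} σ²≡1 (+ g₀) (begin
      + g₀ +ᶻ σ *ᶻ + r              ≡⟨ flip (+ g₀) (+ r) σ ⟩
      + g₀ -ᶻ + r *ᶻ -ᶻ σ           ≡⟨ cong₂ (λ a b → a -ᶻ + r *ᶻ b) (sym g≡g₀) (sym cassini-AB) ⟩
      g -ᶻ + r *ᶻ drift N A         ≡⟨ tr ⟩
      + g₀ +ᶻ σ *ᶻ + c              ∎)))
      where
      open ≡-Reasoning
      g≡g₀ : g ≡ + g₀
      g≡g₀ = isGφ-unique {v = + t} (subst (λ z → IsGφ g (+ z)) origin on) g₀≡Gt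
      flip : ∀ g R σ → g +ᶻ σ *ᶻ R ≡ g -ᶻ R *ᶻ -ᶻ σ
      flip = solve-∀

    reach : ∀ j → j ≤ r →
            ∃[ y ] ∃[ g ] ∃[ m ] (y < N × IsGφ g (+ (t + r * y)) × g -ᶻ + r *ᶻ m ≡ + g₀ +ᶻ σ *ᶻ + j)
    reach j j≤r with counter-takes-values (λ k → c (walk k)) refl (λ k → proj₂ (step (walk k))) N j
                                          (subst (j ≤_) (sym returns) j≤r)
    ... | k , refl = y (walk k) , g (walk k) , drift k (laps (walk k)) , y<N (walk k) , on-graph (walk k) , tracks (walk k)

-- The walk with B = F h and C = F (h - 1), so that A = F (h + 1) and
-- N = F (h + 2), and σ = (-1)ʰ; here r = r′ + 1, h = hh + 1, and φ^h>r
-- says φʰ - r > 0.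
module FibonacciSteps (r′ hh : ℕ) (φ^h>r : Positive (+ F hh -ᶻ + suc r′ , + F (suc hh))) where

  r h : ℕ
  r = suc r′
  h = suc hh

  σ : ℤ
  σ = -1ℤ ^ h

  open Walk r (F h) (F hh) using (A; N; up-step; down-step; drift)

  cassini-AB : drift N A ≡ -ᶻ σ
  cassini-AB = begin
    + (N * F h) -ᶻ + (A * A)                      ≡⟨ cong₂ _-ᶻ_ (ℤ.pos-* N (F h)) (ℤ.pos-* A A) ⟩
    (+ A +ᶻ + F h) *ᶻ + F h -ᶻ + A *ᶻ + A         ≡⟨ negate (+ A) (+ F h) ⟩
    -ᶻ (+ A *ᶻ + A -ᶻ + A *ᶻ + F h -ᶻ + F h *ᶻ + F h) ≡⟨ cong -ᶻ_ (cassini h) ⟩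
    -ᶻ σ                                          ∎
    where
    open ≡-Reasoning
    negate : ∀ a b → (a +ᶻ b) *ᶻ b -ᶻ a *ᶻ a ≡ -ᶻ (a *ᶻ a -ᶻ a *ᶻ b -ᶻ b *ᶻ b)
    negate = solve-∀

  rψ^h≡σup-step : + r ⊛ σ ⊛ ψ^ h ≡ σ ⊛ up-step
  rψ^h≡σup-step = cong₂ _,_ (swap σ (+ r) (+ A)) (swap⁻ σ (+ r) (+ F h))
    where
    swap : ∀ σ R a → R *ᶻ (σ *ᶻ a) ≡ σ *ᶻ (R *ᶻ a)
    swap = solve-∀
    swap⁻ : ∀ σ R b → R *ᶻ (σ *ᶻ -ᶻ b) ≡ σ *ᶻ -ᶻ (R *ᶻ b)
    swap⁻ = solve-∀

  rψ^hh≡σdown-step : + r ⊛ -1ℤ ^ hh ⊛ ψ^ hh ≡ σ ⊛ down-step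
  rψ^hh≡σdown-step = cong₂ _,_ (flip (-1ℤ ^ hh) (+ r) (+ F h)) (flip⁻ (-1ℤ ^ hh) (+ r) (+ F hh))
    where
    flip : ∀ e R b → R *ᶻ (e *ᶻ b) ≡ (-1ℤ *ᶻ e) *ᶻ -ᶻ (R *ᶻ b)
    flip = solve-∀
    flip⁻ : ∀ e R c → R *ᶻ (e *ᶻ -ᶻ c) ≡ (-1ℤ *ᶻ e) *ᶻ -ᶻ (-ᶻ (R *ᶻ c))
    flip⁻ = solve-∀

  up>0 : Positive (σ ⊛ up-step)
  up>0 = subst Positive rψ^h≡σup-step (positive-scale r′ (positive-ψ^ h))

  down>0 : Positive (σ ⊛ down-step)
  down>0 = subst Positive rψ^hh≡σdown-step (positive-scale r′ (positive-ψ^ hh))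

  -- Multiplied by φʰ⁻¹, the condition φ - σ · down-step > 0 is exactly φʰ - r > 0.
  down<φ : Positive (φ ⊟ σ ⊛ down-step)
  down<φ = positive-unφ^ hh (subst Positive (sym scaled) φ^h>r)
    where
    e = -1ℤ ^ hh
    scaled : φ^ hh ⊙ (φ ⊟ σ ⊛ down-step) ≡ (+ F hh -ᶻ + r , + F h)
    scaled = begin
      φ^ hh ⊙ (φ ⊟ σ ⊛ down-step)                     ≡⟨ cong (λ z → φ^ hh ⊙ (φ ⊟ z)) rψ^hh≡σdown-step ⟨
      φ^ hh ⊙ (φ ⊟ + r ⊛ e ⊛ ψ^ hh)                   ≡⟨ φ^-⊟ hh φ (+ r ⊛ e ⊛ ψ^ hh) ⟩
      (φ^ hh ⊙ φ) ⊟ (φ^ hh ⊙ + r ⊛ e ⊛ ψ^ hh)         ≡⟨ cong₂ _⊟_ (φ^-φ hh) (trans (φ^-⊛ hh (+ r) (e ⊛ ψ^ hh))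
                                                         (cong (+ r ⊛_) (trans (φ^-⊛ hh e (ψ^ hh)) (cong (e ⊛_) (φ^-ψ^ hh))))) ⟩
      (+ F hh , + F h) ⊟ + r ⊛ e ⊛ (e , 0ℤ)            ≡⟨ cong₂ _,_ (cong (λ z → + F hh +ᶻ -ᶻ (+ r *ᶻ z)) (±1-square (-1^-cases hh)))
                                                                   (vanish (+ F h) (+ r) e) ⟩
      (+ F hh -ᶻ + r *ᶻ 1ℤ , + F h)                   ≡⟨ cong (λ z → + F hh -ᶻ z , + F h) (ℤ.*-identityʳ (+ r)) ⟩
      (+ F hh -ᶻ + r , + F h)                         ∎
      where
      open ≡-Reasoning
      vanish : ∀ b R e → b +ᶻ -ᶻ (R *ᶻ (e *ᶻ 0ℤ)) ≡ b
      vanish = solve-∀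

  -- σ (down-step - up-step) = r (-1)ʰ⁺¹ ψʰ⁺¹ > 0.
  up<φ : Positive (φ ⊟ σ ⊛ up-step)
  up<φ = subst Positive (cong₂ _,_ (merge₁ (-1ℤ ^ hh) (+ r) (+ F h) (+ F hh)) (merge₂ (-1ℤ ^ hh) (+ r) (+ F h) (+ F hh)))
               (positive-⊕ down<φ (positive-scale r′ (positive-ψ^ (suc h))))
    where
    merge₁ : ∀ e R b c → 0ℤ +ᶻ -ᶻ ((-1ℤ *ᶻ e) *ᶻ -ᶻ (R *ᶻ b)) +ᶻ R *ᶻ ((-1ℤ *ᶻ (-1ℤ *ᶻ e)) *ᶻ (b +ᶻ c +ᶻ b))
                         ≡ 0ℤ +ᶻ -ᶻ ((-1ℤ *ᶻ e) *ᶻ (R *ᶻ (b +ᶻ c)))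
    merge₁ = solve-∀
    merge₂ : ∀ e R b c → 1ℤ +ᶻ -ᶻ ((-1ℤ *ᶻ e) *ᶻ -ᶻ (-ᶻ (R *ᶻ c))) +ᶻ R *ᶻ ((-1ℤ *ᶻ (-1ℤ *ᶻ e)) *ᶻ -ᶻ (b +ᶻ c))
                         ≡ 1ℤ +ᶻ -ᶻ ((-1ℤ *ᶻ e) *ᶻ -ᶻ (R *ᶻ b))
    merge₂ = solve-∀

  L : ℕ
  L = F hh + A

  lucas-product : + (N * L) ≡ + F (suc (suc h + h)) +ᶻ σ
  lucas-product = begin
    + (N * L)                                                  ≡⟨ ℤ.pos-* N L ⟩
    + N *ᶻ + L                                                 ≡⟨ expand b c ⟩
    + N *ᶻ + A +ᶻ + A *ᶻ b +ᶻ -1ℤ *ᶻ (b *ᶻ b -ᶻ b *ᶻ c -ᶻ c *ᶻ c) ≡⟨ cong (λ z → + N *ᶻ + A +ᶻ + A *ᶻ b +ᶻ -1ℤ *ᶻ z) (cassini hh) ⟩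
    + N *ᶻ + A +ᶻ + A *ᶻ b +ᶻ σ                                ≡⟨ cong₂ (λ x y → x +ᶻ y +ᶻ σ) (ℤ.pos-* N A) (ℤ.pos-* A (F h)) ⟨
    + (N * A + A * F h) +ᶻ σ                                   ≡⟨ cong (λ z → + z +ᶻ σ) (F-+ (suc h) h) ⟨
    + F (suc (suc h + h)) +ᶻ σ                                 ∎
    where
    open ≡-Reasoning
    b = + F h
    c = + F hh
    expand : ∀ b c → (b +ᶻ c +ᶻ b) *ᶻ (c +ᶻ (b +ᶻ c))
                   ≡ (b +ᶻ c +ᶻ b) *ᶻ (b +ᶻ c) +ᶻ (b +ᶻ c) *ᶻ b +ᶻ -1ℤ *ᶻ (b *ᶻ b -ᶻ b *ᶻ c -ᶻ c *ᶻ c)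
    expand = solve-∀

  -- L = φʰ + ψʰ with |ψʰ| < 1.
  lucas-vector : (+ F hh -ᶻ + r , + F h) ⊕ ψ^ h ≡ (+ L -ᶻ + r , 0ℤ)
  lucas-vector = cong₂ _,_ (swap (+ F hh) (+ r) (+ A)) (ℤ.+-inverseʳ (+ F h))
    where
    swap : ∀ c R a → c -ᶻ R +ᶻ a ≡ c +ᶻ a -ᶻ R
    swap = solve-∀

  r<L : σ ≡ 1ℤ → r < L
  r<L σ≡1 = positive-difference L r (subst Positive lucas-vector (positive-⊕ φ^h>r ψ^h>0))
    where
    ψ^h>0 : Positive (ψ^ h)
    ψ^h>0 = subst Positive (trans (cong (_⊛ ψ^ h) σ≡1) (⊛-identityˡ (ψ^ h))) (positive-ψ^ h)

  r≤L : σ ≡ -1ℤ → r ≤ L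
  r≤L σ≡-1 = ℕ.≤-pred (positive-difference (suc L) r (subst Positive rearrange (positive-⊕ φ^h>r 1+ψ^h>0)))
    where
    1+ψ^h>0 : Positive ((1ℤ , 0ℤ) ⊕ ψ^ h)
    1+ψ^h>0 = positive-unφ^ h (subst Positive (sym scaled) (positive-⊕-nonNegative φ^h>r (nonNegative-ℕ r′)))
      where
      scaled : φ^ h ⊙ ((1ℤ , 0ℤ) ⊕ ψ^ h) ≡ (+ F hh -ᶻ + r , + F h) ⊕ (+ r′ , 0ℤ)
      scaled = begin
        φ^ h ⊙ ((1ℤ , 0ℤ) ⊕ ψ^ h)              ≡⟨ φ^-⊕ h (1ℤ , 0ℤ) (ψ^ h) ⟩
        (φ^ hh ⊙ φ) ⊕ (φ^ h ⊙ ψ^ h)            ≡⟨ cong₂ _⊕_ (φ^-φ hh) (trans (φ^-ψ^ h) (cong (_, 0ℤ) σ≡-1)) ⟩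
        (+ F hh , + F h) ⊕ (-1ℤ , 0ℤ)          ≡⟨ cong (_, + F h +ᶻ 0ℤ) (borrow (+ F hh) (+ r′)) ⟩
        (+ F hh -ᶻ + r , + F h) ⊕ (+ r′ , 0ℤ)  ∎
        where
        open ≡-Reasoning
        borrow : ∀ c x → c +ᶻ -1ℤ ≡ c -ᶻ (1ℤ +ᶻ x) +ᶻ x
        borrow = solve-∀
    rearrange : (+ F hh -ᶻ + r , + F h) ⊕ ((1ℤ , 0ℤ) ⊕ ψ^ h) ≡ (+ suc L -ᶻ + r , 0ℤ)
    rearrange = cong₂ _,_ (swap (+ F hh) (+ r) (+ A)) (trans (cong (+ F h +ᶻ_) (ℤ.+-identityˡ (-ᶻ + F h))) (ℤ.+-inverseʳ (+ F h)))
      where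
      swap : ∀ c R a → c -ᶻ R +ᶻ (1ℤ +ᶻ a) ≡ 1ℤ +ᶻ (c +ᶻ a) -ᶻ R
      swap = solve-∀

  rN+2≤F : σ ≡ 1ℤ → r * N + 2 ≤ F (suc (suc h + h))
  rN+2≤F σ≡1 = ℕ.+-cancelʳ-≤ 1 (r * N + 2) (F (suc (suc h + h))) (begin
    r * N + 2 + 1      ≡⟨ ℕ.+-assoc (r * N) 2 1 ⟩
    r * N + 3          ≤⟨ ℕ.+-monoʳ-≤ (r * N) (3≤F-even hh σ≡1) ⟩
    r * N + N          ≡⟨ ℕ.+-comm (r * N) N ⟩
    suc r * N          ≤⟨ ℕ.*-monoˡ-≤ N (r<L σ≡1) ⟩
    L * N              ≡⟨ ℕ.*-comm L N ⟩
    N * L              ≡⟨ ℤ.+-injective (trans lucas-product (cong (+ F (suc (suc h + h)) +ᶻ_) σ≡1)) ⟩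
    F (suc (suc h + h)) + 1 ∎)
    where open ℕ.≤-Reasoning

  rN+1≤F : r * N + 1 ≤ F (suc (suc h + h))
  rN+1≤F with -1^-cases h
  ... | inj₁ σ≡1  = ℕ.≤-trans (ℕ.+-monoʳ-≤ (r * N) (s≤s z≤n)) (rN+2≤F σ≡1)
  ... | inj₂ σ≡-1 = begin
    r * N + 1          ≤⟨ ℕ.+-monoˡ-≤ 1 (ℕ.*-monoˡ-≤ N (r≤L σ≡-1)) ⟩
    L * N + 1          ≡⟨ cong (_+ 1) (ℕ.*-comm L N) ⟩
    N * L + 1          ≡⟨ ℤ.+-injective (trans (cong (_+ᶻ 1ℤ) (trans lucas-product (cong (+ F (suc (suc h + h)) +ᶻ_) σ≡-1)))
                                               (cancel (+ F (suc (suc h + h))))) ⟩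
    F (suc (suc h + h)) ∎
    where
    open ℕ.≤-Reasoning
    cancel : ∀ x → x +ᶻ -1ℤ +ᶻ 1ℤ ≡ x
    cancel = solve-∀

-- For odd m = k + 1, r F (m + 1) + 1 - r F m φ = 1 + r ψᵐ lies in (0 , φ)
-- when r < φᵐ.
isGφ-multiple : ∀ r′ k → -1ℤ ^ suc k ≡ -1ℤ → Positive (+ F k -ᶻ + suc r′ , + F (suc k)) →
                IsGφ (+ (suc r′ * F (suc k))) (+ (suc r′ * F (suc (suc k))))
isGφ-multiple r′ k odd φ^k>r =
  inj₁ (subst Positive lower-eq lower>0) , subst Positive upper-eq upper>0
  where
  R a b : ℤ
  R = + suc r′
  a = + F (suc (suc k))
  b = + F (suc k)
  lower>0 : Positive ((1ℤ , 0ℤ) ⊕ R ⊛ ψ^ (suc k))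
  lower>0 = positive-unφ^ (suc k) (subst Positive (sym scaled) φ^k>r)
    where
    scaled : φ^ suc k ⊙ ((1ℤ , 0ℤ) ⊕ R ⊛ ψ^ (suc k)) ≡ (+ F k -ᶻ R , b)
    scaled = begin
      φ^ suc k ⊙ ((1ℤ , 0ℤ) ⊕ R ⊛ ψ^ (suc k))            ≡⟨ φ^-⊕ (suc k) (1ℤ , 0ℤ) (R ⊛ ψ^ (suc k)) ⟩
      (φ^ k ⊙ φ) ⊕ (φ^ suc k ⊙ R ⊛ ψ^ (suc k))            ≡⟨ cong₂ _⊕_ (φ^-φ k) (trans (φ^-⊛ (suc k) R (ψ^ (suc k)))
                                                             (cong (R ⊛_) (trans (φ^-ψ^ (suc k)) (cong (_, 0ℤ) odd)))) ⟩
      (+ F k , b) ⊕ R ⊛ (-1ℤ , 0ℤ)                         ≡⟨ cong₂ _,_ (negate (+ F k) R) (vanish b R) ⟩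
      (+ F k -ᶻ R , b)                                     ∎
      where
      open ≡-Reasoning
      negate : ∀ c R → c +ᶻ R *ᶻ -1ℤ ≡ c -ᶻ R
      negate = solve-∀
      vanish : ∀ b R → b +ᶻ R *ᶻ 0ℤ ≡ b
      vanish = solve-∀
  lower-eq : (1ℤ , 0ℤ) ⊕ R ⊛ ψ^ (suc k) ≡ lowerGap (+ (suc r′ * F (suc k))) (+ (suc r′ * F (suc (suc k))))
  lower-eq = cong₂ _,_ (trans (ℤ.+-comm 1ℤ (R *ᶻ a)) (cong (_+ᶻ 1ℤ) (sym (ℤ.pos-* (suc r′) (F (suc (suc k)))))))
                       (trans (shuffle R b) (cong -ᶻ_ (sym (ℤ.pos-* (suc r′) (F (suc k))))))
    where
    shuffle : ∀ R b → 0ℤ +ᶻ R *ᶻ -ᶻ b ≡ -ᶻ (R *ᶻ b)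
    shuffle = solve-∀
  upper>0 : Positive ((-1ℤ , 1ℤ) ⊕ R ⊛ -1ℤ ^ suc k ⊛ ψ^ (suc k))
  upper>0 = positive-⊕ { -1ℤ , 1ℤ} (1 , s≤s z≤n) (positive-scale r′ (positive-ψ^ (suc k)))
  upper-eq : (-1ℤ , 1ℤ) ⊕ R ⊛ -1ℤ ^ suc k ⊛ ψ^ (suc k) ≡ upperGap (+ (suc r′ * F (suc k))) (+ (suc r′ * F (suc (suc k))))
  upper-eq = cong₂ _,_
    (trans (cong (λ e → -1ℤ +ᶻ R *ᶻ (e *ᶻ a)) odd) (trans (shuffleˡ R a) (cong (λ z → -ᶻ (z +ᶻ 1ℤ)) (sym (ℤ.pos-* (suc r′) (F (suc (suc k))))))))
    (trans (cong (λ e → 1ℤ +ᶻ R *ᶻ (e *ᶻ -ᶻ b)) odd) (trans (shuffleʳ R b) (cong (_+ᶻ 1ℤ) (sym (ℤ.pos-* (suc r′) (F (suc k)))))))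
    where
    shuffleˡ : ∀ R a → -1ℤ +ᶻ R *ᶻ (-1ℤ *ᶻ a) ≡ -ᶻ (R *ᶻ a +ᶻ 1ℤ)
    shuffleˡ = solve-∀
    shuffleʳ : ∀ R b → 1ℤ +ᶻ R *ᶻ (-1ℤ *ᶻ -ᶻ b) ≡ R *ᶻ b +ᶻ 1ℤ
    shuffleʳ = solve-∀

φ^-minus-positive : ∀ r k → r <φ^ suc k → Positive (+ F k -ᶻ + r , + F (suc k))
φ^-minus-positive r k r<φ^k =
  subst Positive (cong₂ _,_ (truncated-difference (F k) r) (ℤ.+-identityʳ (+ F (suc k))))
    (positive-⊕-nonNegative (<φ·⇒positive (r ∸ F k) (F (suc k)) r<φ^k) (nonNegative-ℕ (F k ∸ r)))

-- φᵏ⁺¹ - r = φ (φᵏ - r) + r (φ - 1).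
φ^-minus-positive-suc : ∀ r′ k → Positive (+ F k -ᶻ + suc r′ , + F (suc k)) →
                        Positive (+ F (suc k) -ᶻ + suc r′ , + F (suc (suc k)))
φ^-minus-positive-suc r′ k φ^k>r =
  subst Positive (cong₂ _,_ (shuffleˡ (+ F (suc k)) (+ suc r′)) (shuffleʳ (+ F k) (+ F (suc k)) (+ suc r′)))
    (positive-⊕ (positive-φ^ 1 φ^k>r) (positive-scale r′ { -1ℤ , 1ℤ} (1 , s≤s z≤n)))
  where
  shuffleˡ : ∀ b R → b +ᶻ R *ᶻ -1ℤ ≡ b -ᶻ R
  shuffleˡ = solve-∀
  shuffleʳ : ∀ c b R → c -ᶻ R +ᶻ b +ᶻ R *ᶻ 1ℤ ≡ b +ᶻ c
  shuffleʳ = solve-∀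

-- Residues modulo r

≡-mod-from-ℤ : ∀ r .{{_ : NonZero r}} u s (z : ℤ) → + u ≡ + s +ᶻ + r *ᶻ z → u % r ≡ s % r
≡-mod-from-ℤ r u s (+ k) eq = trans (cong (_% r) u≡s+kr) ([m+kn]%n≡m%n s k r)
  where
  u≡s+kr : u ≡ s + k * r
  u≡s+kr = ℤ.+-injective (trans eq (cong (λ z → + s +ᶻ z) (trans (sym (ℤ.pos-* r k)) (cong +_ (ℕ.*-comm r k)))))
≡-mod-from-ℤ r u s -[1+ k ] eq = sym (trans (cong (_% r) s≡u+kr) ([m+kn]%n≡m%n u (suc k) r))
  where
  s≡u+kr : s ≡ u + suc k * r
  s≡u+kr = ℤ.+-injective (begin
    + s                                 ≡⟨ isolate (+ s) (+ r) (+ suc k) ⟩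
    + s +ᶻ + r *ᶻ -[1+ k ] +ᶻ + r *ᶻ + suc k ≡⟨ cong (_+ᶻ + r *ᶻ + suc k) eq ⟨
    + u +ᶻ + r *ᶻ + suc k               ≡⟨ cong (λ z → + u +ᶻ z) (trans (sym (ℤ.pos-* r (suc k))) (cong +_ (ℕ.*-comm r (suc k)))) ⟩
    + (u + suc k * r)                   ∎)
    where
    open ≡-Reasoning
    isolate : ∀ s R k → s ≡ s +ᶻ R *ᶻ -ᶻ k +ᶻ R *ᶻ k
    isolate = solve-∀

complement-mod : ∀ r a b → a < r → b < r → ∃[ j ] ∃[ δ ] (j ≤ r × a + j ≡ b + r * δ)
complement-mod r a b a<r b<r with a ≤? b
... | yes a≤b = b ∸ a , 0 , ℕ.≤-trans (ℕ.m∸n≤m b a) (ℕ.<⇒≤ b<r) ,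
                trans (ℕ.m+[n∸m]≡n a≤b) (sym (trans (cong (_+_ b) (ℕ.*-zeroʳ r)) (ℕ.+-identityʳ b)))
... | no a≰b = b + r ∸ a , 1 ,
               ℕ.≤-trans (ℕ.∸-monoʳ-≤ (b + r) (ℕ.<⇒≤ (ℕ.≰⇒> a≰b))) (ℕ.≤-reflexive (ℕ.m+n∸m≡n b r)) ,
               trans (ℕ.m+[n∸m]≡n (ℕ.≤-trans (ℕ.<⇒≤ a<r) (ℕ.m≤n+m r b))) (cong (_+_ b) (sym (ℕ.*-identityʳ r)))

residue-reachable : ∀ r σ → σ ≡ 1ℤ ⊎ σ ≡ -1ℤ → ∀ a b → a < r → b < r →
                    ∃[ j ] ∃[ z ] (j ≤ r × + a +ᶻ σ *ᶻ + j ≡ + b +ᶻ + r *ᶻ z)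
residue-reachable r .1ℤ (inj₁ refl) a b a<r b<r with complement-mod r a b a<r b<r
... | j , δ , j≤r , eq = j , + δ , j≤r , (begin
  + a +ᶻ 1ℤ *ᶻ + j       ≡⟨ cong (+ a +ᶻ_) (ℤ.*-identityˡ (+ j)) ⟩
  + (a + j)              ≡⟨ cong +_ eq ⟩
  + (b + r * δ)          ≡⟨ cong (+ b +ᶻ_) (ℤ.pos-* r δ) ⟩
  + b +ᶻ + r *ᶻ + δ      ∎)
  where open ≡-Reasoning
residue-reachable r .-1ℤ (inj₂ refl) a b a<r b<r with complement-mod r b a b<r a<r
... | j , δ , j≤r , eq = j , -ᶻ + δ , j≤r , (begin
  + a +ᶻ -1ℤ *ᶻ + j                                      ≡⟨ isolate (+ a) (+ b) (+ j) (+ r) (+ δ) ⟩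
  + b +ᶻ + r *ᶻ -ᶻ + δ -ᶻ (+ (b + j) -ᶻ (+ a +ᶻ + r *ᶻ + δ)) ≡⟨ cong (λ x → + b +ᶻ + r *ᶻ -ᶻ + δ -ᶻ (x -ᶻ (+ a +ᶻ + r *ᶻ + δ)))
                                                                  (trans (cong +_ eq) (cong (+ a +ᶻ_) (ℤ.pos-* r δ))) ⟩
  + b +ᶻ + r *ᶻ -ᶻ + δ -ᶻ (+ a +ᶻ + r *ᶻ + δ -ᶻ (+ a +ᶻ + r *ᶻ + δ)) ≡⟨ cancel (+ b +ᶻ + r *ᶻ -ᶻ + δ) (+ a +ᶻ + r *ᶻ + δ) ⟩
  + b +ᶻ + r *ᶻ -ᶻ + δ                                   ∎)
  where
  open ≡-Reasoning
  isolate : ∀ a b j R d → a +ᶻ -1ℤ *ᶻ j ≡ b +ᶻ R *ᶻ -ᶻ d -ᶻ ((b +ᶻ j) -ᶻ (a +ᶻ R *ᶻ d))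
  isolate = solve-∀
  cancel : ∀ w x → w -ᶻ (x -ᶻ x) ≡ w
  cancel = solve-∀

-- Fibonacci representations

digit : Bool → ℕ → ℕ
digit b i = if b then F i else 0

fibSumFrom-∷ : ∀ k b β → fibSumFrom k (b ∷ β) ≡ digit b k + fibSumFrom (suc k) β
fibSumFrom-∷ k true  β = refl
fibSumFrom-∷ k false β = refl

fibSumFrom-∷ʳ : ∀ k β b → fibSumFrom k (β ∷ʳ b) ≡ fibSumFrom k β + digit b (k + length β)
fibSumFrom-∷ʳ k []      true  = trans (ℕ.+-identityʳ (F k)) (cong F (sym (ℕ.+-identityʳ k)))
fibSumFrom-∷ʳ k []      false = refl
fibSumFrom-∷ʳ k (c ∷ β) b     = begin
  fibSumFrom k (c ∷ β ∷ʳ b)                                      ≡⟨ fibSumFrom-∷ k c (β ∷ʳ b) ⟩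
  digit c k + fibSumFrom (suc k) (β ∷ʳ b)                         ≡⟨ cong (_+_ (digit c k)) (fibSumFrom-∷ʳ (suc k) β b) ⟩
  digit c k + (fibSumFrom (suc k) β + digit b (suc k + length β)) ≡⟨ ℕ.+-assoc (digit c k) _ _ ⟨
  digit c k + fibSumFrom (suc k) β + digit b (suc k + length β)   ≡⟨ cong (_+ digit b (suc k + length β)) (fibSumFrom-∷ k c β) ⟨
  fibSumFrom k (c ∷ β) + digit b (suc k + length β)               ≡⟨ cong (λ i → fibSumFrom k (c ∷ β) + digit b i) (ℕ.+-suc k (length β)) ⟨
  fibSumFrom k (c ∷ β) + digit b (k + length (c ∷ β))             ∎
  where open ≡-Reasoning

length-∷ʳ : ∀ (β : List Bool) b → length (β ∷ʳ b) ≡ suc (length β)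
length-∷ʳ β b = trans (length-++ β) (ℕ.+-comm (length β) 1)

leading-digit : ∀ n v → ¬ (v + 2 ≤ F (3 + n)) → F (2 + n) ≤ v
leading-digit n v v+2≰F = ℕ.+-cancelʳ-≤ 1 (F (2 + n)) v (begin
  F (2 + n) + 1          ≤⟨ ℕ.+-monoʳ-≤ (F (2 + n)) (F-positive n) ⟩
  F (3 + n)              ≤⟨ ℕ.≤-pred (subst (suc (F (3 + n)) ≤_) (ℕ.+-suc v 1) (ℕ.≰⇒> v+2≰F)) ⟩
  v + 1                  ∎)
  where open ℕ.≤-Reasoning

-- Greedily from the top: F (n + 2) is used iff v + 2 > F (n + 3).
fibonacci-representation : ∀ n v → v + 2 ≤ F (3 + n) → ∃[ β ] (length β ≡ n × FibSum β ≡ v)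
fibonacci-representation zero    zero    _     = [] , refl , refl
fibonacci-representation zero    (suc v) v+2≤2 = ⊥-elim (ℕ.1+n≰n (ℕ.≤-trans (s≤s (ℕ.m≤n+m 2 v)) v+2≤2))
fibonacci-representation (suc n) v       v+2≤F with v + 2 ≤? F (3 + n)
... | yes v+2≤F′ with fibonacci-representation n v v+2≤F′
...   | β , len , sum = β ∷ʳ false , trans (length-∷ʳ β false) (cong suc len) ,
                        trans (fibSumFrom-∷ʳ 2 β false) (trans (ℕ.+-identityʳ _) sum)
fibonacci-representation (suc n) v v+2≤F | no v+2≰F′ with fibonacci-representation n (v ∸ F (2 + n)) rest-bound
  where
  rest-bound : v ∸ F (2 + n) + 2 ≤ F (3 + n)
  rest-bound = ℕ.+-cancelʳ-≤ (F (2 + n)) _ _ (begin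
    v ∸ F (2 + n) + 2 + F (2 + n)   ≡⟨ swap (v ∸ F (2 + n)) 2 (F (2 + n)) ⟩
    v ∸ F (2 + n) + F (2 + n) + 2   ≡⟨ cong (_+ 2) (ℕ.m∸n+n≡m (leading-digit n v v+2≰F′)) ⟩
    v + 2                           ≤⟨ v+2≤F ⟩
    F (3 + n) + F (2 + n)           ∎)
    where
    open ℕ.≤-Reasoning
    swap : ∀ a b c → a + b + c ≡ a + c + b
    swap = solve-∀ℕ
... | β , len , sum = β ∷ʳ true , trans (length-∷ʳ β true) (cong suc len) , (begin
  fibSumFrom 2 (β ∷ʳ true)               ≡⟨ fibSumFrom-∷ʳ 2 β true ⟩
  FibSum β + F (2 + length β)            ≡⟨ cong₂ (λ x l → x + F (2 + l)) sum len ⟩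
  v ∸ F (2 + n) + F (2 + n)              ≡⟨ ℕ.m∸n+n≡m (leading-digit n v v+2≰F′) ⟩
  v                                      ∎)
  where open ≡-Reasoning

module ResidueCovering (r′ hh : ℕ) (φ^h>r : Positive (+ F hh -ᶻ + suc r′ , + F (suc hh))) where

  open FibonacciSteps r′ hh φ^h>r
  open Walk r (F h) (F hh) using (A; N)

  GPairWithResidues : ℕ → ℕ → Set
  GPairWithResidues s t = ∃[ u ] ∃[ v ] (HofstadterGPair u v × u % r ≡ s % r × v % r ≡ t % r × v + 2 ≤ F (suc (suc h + h)))

  multiple-positive : ∀ k → 0 < r * F (suc k)
  multiple-positive k = ℕ.*-mono-≤ {1} {r} {1} {F (suc k)} (s≤s z≤n) (F-positive k)

  multiple-%r : ∀ x → (r * x) % r ≡ 0 % r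
  multiple-%r x = trans (cong (_% r) (ℕ.*-comm r x)) (m*n%n≡0 x r)

  zero-residues : GPairWithResidues 0 0
  zero-residues with -1^-cases h
  ... | inj₂ odd  = r * F h , r * A ,
                    (multiple-positive hh , multiple-positive h , isGφ⇒IsG _ _ (isGφ-multiple r′ hh odd φ^h>r)) ,
                    multiple-%r (F h) , multiple-%r A , bound
    where
    bound : r * A + 2 ≤ F (suc (suc h + h))
    bound = begin
      r * A + 2          ≡⟨ ℕ.+-assoc (r * A) 1 1 ⟨
      r * A + 1 + 1      ≤⟨ ℕ.+-monoˡ-≤ 1 (ℕ.+-monoʳ-≤ (r * A) (multiple-positive hh)) ⟩
      r * A + r * F h + 1 ≡⟨ cong (_+ 1) (ℕ.*-distribˡ-+ r A (F h)) ⟨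
      r * N + 1          ≤⟨ rN+1≤F ⟩
      F (suc (suc h + h)) ∎
      where open ℕ.≤-Reasoning
  ... | inj₁ even = r * A , r * N ,
                    (multiple-positive h , multiple-positive (suc h) ,
                     isGφ⇒IsG _ _ (isGφ-multiple r′ h (cong (-1ℤ *ᶻ_) even) (φ^-minus-positive-suc r′ hh φ^h>r))) ,
                    multiple-%r A , multiple-%r N , rN+2≤F even

  reach-residue : ∀ s t → s < r → t < r → ∃[ y ] ∃[ u ] (y < N × IsGφ (+ u) (+ (t + r * y)) × u % r ≡ s % r)
  reach-residue s t s<r t<r =
    let (g₀ , g₀≡Gt , g₀≤t) = G-exists t
        (j , z , j≤r , g₀+σj≡s+rz) = residue-reachable r σ (-1^-cases h) g₀ s (ℕ.≤-<-trans g₀≤t t<r) s<r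
        open Walk.Run r (F h) (F hh) t g₀ σ (-1^-cases h) (F-positive hh) g₀≡Gt cassini-AB up>0 up<φ down>0 down<φ
        (y , g , m , y<N , g≡Gv , g-rm≡g₀+σj) = reach j j≤r
        (u , u≡Gv , _) = G-exists (t + r * y)
    in y , u , y<N , u≡Gv ,
       ≡-mod-from-ℤ r u s (m +ᶻ z) (trans (isGφ-unique {v = + (t + r * y)} u≡Gv g≡Gv) (compose-offsets {s = + s} (+ r) m z g-rm≡g₀+σj g₀+σj≡s+rz))

  walk-pair : ∀ s t y u → s < r → t < r → ¬ (s ≡ 0 × t ≡ 0) →
              y < N → IsGφ (+ u) (+ (t + r * y)) → u % r ≡ s % r → GPairWithResidues s t
  walk-pair s t y u s<r t<r not-both-0 y<N u≡Gv u≡s =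
    u , v , (G-positive 0<v u≡Gv , 0<v , isGφ⇒IsG u v u≡Gv) , u≡s , v≡t , bound
    where
    v = t + r * y
    v≡t : v % r ≡ t % r
    v≡t = trans (cong (λ x → (t + x) % r) (ℕ.*-comm r y)) ([m+kn]%n≡m%n t y r)
    0<v : 0 < v
    0<v = ℕ.n≢0⇒n>0 λ v≡0 → not-both-0 (s≡0 v≡0 , ℕ.m+n≡0⇒m≡0 t v≡0)
      where
      s≡0 : v ≡ 0 → s ≡ 0
      s≡0 v≡0 = begin
        s          ≡⟨ m<n⇒m%n≡m s<r ⟨
        s % r      ≡⟨ u≡s ⟨
        u % r      ≡⟨ cong (_% r) (ℤ.+-injective {u} {0} (isGφ-unique {v = + v} u≡Gv (subst (λ x → IsGφ (+ 0) (+ x)) (sym v≡0) (proj₁ (proj₂ (G-exists 0)))))) ⟩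
        0          ∎
        where open ≡-Reasoning
    bound : v + 2 ≤ F (suc (suc h + h))
    bound = begin
      t + r * y + 2      ≡⟨ ℕ.+-assoc t (r * y) 2 ⟩
      t + (r * y + 2)    ≡⟨ cong (_+_ t) (ℕ.+-comm (r * y) 2) ⟩
      t + (2 + r * y)    ≡⟨ ℕ.+-suc t (1 + r * y) ⟩
      suc t + (1 + r * y) ≤⟨ ℕ.+-monoˡ-≤ (1 + r * y) t<r ⟩
      r + (1 + r * y)    ≡⟨ ℕ.+-comm r (1 + r * y) ⟩
      1 + r * y + r      ≡⟨ cong suc (trans (ℕ.+-comm (r * y) r) (sym (ℕ.*-suc r y))) ⟩
      1 + r * suc y      ≤⟨ s≤s (ℕ.*-monoʳ-≤ r y<N) ⟩
      1 + r * N          ≡⟨ ℕ.+-comm 1 (r * N) ⟩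
      r * N + 1          ≤⟨ rN+1≤F ⟩
      F (suc (suc h + h)) ∎
      where open ℕ.≤-Reasoning

  nonzero-residues : ∀ s t → s < r → t < r → ¬ (s ≡ 0 × t ≡ 0) → GPairWithResidues s t
  nonzero-residues s t s<r t<r not-both-0 =
    let (y , u , y<N , u≡Gv , u≡s) = reach-residue s t s<r t<r
    in walk-pair s t y u s<r t<r not-both-0 y<N u≡Gv u≡s

  G-pair-with-residues : ∀ s t → s < r → t < r → GPairWithResidues s t
  G-pair-with-residues s t s<r t<r with s ≟ 0 | t ≟ 0
  ... | yes refl | yes refl = zero-residues
  ... | no s≢0   | _        = nonzero-residues s t s<r t<r (s≢0 ∘ proj₁)
  ... | yes _    | no t≢0   = nonzero-residues s t s<r t<r (t≢0 ∘ proj₂)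

corollary1 : (r : ℕ) → .{{_ : NonZero r}} → (s t : ℕ) → s < r → t < r →
    (h : ℕ) → 0 < h → r <φ^ h →
    ∃[ u ] ∃[ v ] (HofstadterGPair u v × u % r ≡ s % r × v % r ≡ t % r ×
    ∃[ β ] (length β ≤ 2 * h ∸ 1 × FibSum β ≡ v))
corollary1 (suc r′) s t s<r t<r (suc hh) _ r<φ^h =
  let (u , v , pair , u≡s , v≡t , v+2≤F) = ResidueCovering.G-pair-with-residues r′ hh (φ^-minus-positive (suc r′) hh r<φ^h) s t s<r t<r
      (β , length≡ , FibSum≡v) = fibonacci-representation (2 * suc hh ∸ 1) v (subst (λ i → v + 2 ≤ F i) index v+2≤F)
  in u , v , pair , u≡s , v≡t , β , ℕ.≤-reflexive length≡ , FibSum≡v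
  where
  index : suc (suc (suc hh) + suc hh) ≡ 3 + (2 * suc hh ∸ 1)
  index = cong (λ x → 3 + (hh + suc x)) (sym (ℕ.+-identityʳ hh))
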